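{- Let $G$ be a minimum counterexample. Then $G$ is connected, has minimum degree at least two, and is not a cycle.
   Context: All graphs are finite and simple. A subcubic graph has maximum degree at most $3$. Given lists $L=\{L(v)\}$, a proper $L$-coloring is a map $f$ with $f(v)\in L(v)$ and $f(u)\ne f(v)$ for every edge $uv$; it is linear if any two color classes induce a disjoint union of paths; it is superlinear if it is linear and the two neighbors of every degree-two vertex receive different colors. A graph is superlinearly $4$-choosable if it has a superlinear $L$-coloring for every family $L$ of lists of size $4$. A minimum counterexample is a subcubic graph $G$ with no component isomorphic to $K_{3,3}$ or $C_5$, such that there is a family $L$ of lists of size $4$ for which $G$ has no superlinear $L$-coloring, but every subcubic graph with fewer vertices than $G$ and with no component isomorphic to $K_{3,3}$ or $C_5$ is superlinearly $4$-choosable. -}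

module Defs where

open import Data.Nat using (ℕ; zero; suc; _+_; _≤_; _<_; _%_; _≡ᵇ_; _<ᵇ_)
open import Data.Bool using (Bool; true; false; _∨_; _xor_)
open import Data.Fin using (Fin; toℕ)
open import Data.List using (List; length; filterᵇ; allFin)
open import Data.List.Membership.Propositional using (_∈_)
open import Data.List.Relation.Unary.Unique.Propositional using (Unique)
open import Data.Product using (Σ; ∃; _×_; _,_)
open import Data.Sum using (_⊎_)
open import Relation.Nullary using (¬_)
open import Data.Empty using (⊥)
open import Relation.Binary.PropositionalEquality using (_≡_; _≢_)
open import Function.Bundles using (_↔_; Inverse)
open import Function.Definitions using (Injective)

Graph : ℕ → Set
Graph n = Fin n → Fin n → Bool

-- Simple (undirected, loopless; no multi-edges by construction).
IsSimple : ∀ {n} → Graph n → Set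
IsSimple {n} G = (∀ u v → G u v ≡ G v u) × (∀ v → G v v ≡ false)

deg : ∀ {n} → Graph n → Fin n → ℕ
deg {n} G v = length (filterᵇ (G v) (allFin n))

Subcubic : ∀ {n} → Graph n → Set
Subcubic G = ∀ v → deg G v ≤ 3

cycleGraph : (m : ℕ) → Graph (3 + m)
cycleGraph m i j =
  (toℕ j ≡ᵇ suc (toℕ i) % (3 + m)) ∨ (toℕ i ≡ᵇ suc (toℕ j) % (3 + m))

C5 : Graph 5
C5 = cycleGraph 2

-- K_{3,3} with parts {0,1,2} and {3,4,5}.
K33 : Graph 6
K33 i j = (toℕ i <ᵇ 3) xor (toℕ j <ᵇ 3)

Iso : ∀ {n k} → Graph n → Graph k → Set
Iso {n} {k} G H =
  Σ (Fin n ↔ Fin k) λ φ →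
    ∀ u v → H (Inverse.to φ u) (Inverse.to φ v) ≡ G u v

IsCycle : ∀ {n} → Graph n → Set
IsCycle G = ∃ λ m → Iso G (cycleGraph m)

-- G has a connected component isomorphic to the (connected) graph H:
-- an injective map whose image induces a copy of H and is closed
-- under adjacency in G.
HasComponentIso : ∀ {n k} → Graph n → Graph k → Set
HasComponentIso {n} {k} G H =
  Σ (Fin k → Fin n) λ φ →
    Injective _≡_ _≡_ φ
    × (∀ i j → G (φ i) (φ j) ≡ H i j)
    × (∀ i w → G (φ i) w ≡ true → ∃ λ j → φ j ≡ w)

data Reach {n} (G : Graph n) (u : Fin n) : Fin n → Set where
  here : Reach G u u
  step : ∀ {v w} → Reach G u v → G v w ≡ true → Reach G u w

Connected : ∀ {n} → Graph n → Set
Connected G = ∀ u v → Reach G u v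

ListAssignment : ℕ → Set
ListAssignment n = Fin n → List ℕ

Size4 : ∀ {n} → ListAssignment n → Set
Size4 L = ∀ v → Unique (L v) × length (L v) ≡ 4

ProperLColoring : ∀ {n} → Graph n → ListAssignment n → (Fin n → ℕ) → Set
ProperLColoring G L f =
  (∀ v → f v ∈ L v) × (∀ u v → G u v ≡ true → f u ≢ f v)

-- the subgraph induced by S has maximum degree at most 2
MaxDeg≤2On : ∀ {n} → Graph n → (Fin n → Set) → Set
MaxDeg≤2On G S = ∀ v x y z → S v → S x → S y → S z →
  G v x ≡ true → G v y ≡ true → G v z ≡ true →
  x ≢ y → y ≢ z → x ≢ z → ⊥

HasCycleOn : ∀ {n} → Graph n → (Fin n → Set) → Set
HasCycleOn {n} G S =
  Σ ℕ λ m → Σ (Fin (3 + m) → Fin n) λ c →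
    Injective _≡_ _≡_ c × (∀ i → S (c i))
    × (∀ i j → cycleGraph m i j ≡ true → G (c i) (c j) ≡ true)

LinearForestOn : ∀ {n} → Graph n → (Fin n → Set) → Set
LinearForestOn G S = MaxDeg≤2On G S × ¬ HasCycleOn G S

Linear : ∀ {n} → Graph n → (Fin n → ℕ) → Set
Linear G f = ∀ a b → LinearForestOn G (λ v → f v ≡ a ⊎ f v ≡ b)

SuperlinearLColoring : ∀ {n} → Graph n → ListAssignment n → (Fin n → ℕ) → Set
SuperlinearLColoring G L f =
  ProperLColoring G L f × Linear G f
  × (∀ v x y → deg G v ≡ 2 → G v x ≡ true → G v y ≡ true → x ≢ y → f x ≢ f y)

SuperlinearlyColorable : ∀ {n} → Graph n → ListAssignment n → Set
SuperlinearlyColorable G L = ∃ λ f → SuperlinearLColoring G L f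

Superlinearly4Choosable : ∀ {n} → Graph n → Set
Superlinearly4Choosable {n} G =
  (L : ListAssignment n) → Size4 L → SuperlinearlyColorable G L

Admissible : ∀ {n} → Graph n → Set
Admissible G = IsSimple G × Subcubic G
  × ¬ HasComponentIso G K33 × ¬ HasComponentIso G C5

MinimumCounterexample : ∀ {n} → Graph n → Set
MinimumCounterexample {n} G =
  Admissible G
  × (∃ λ (L : ListAssignment n) → Size4 L × ¬ SuperlinearlyColorable G L)
  × (∀ m → m < n → (H : Graph m) → Admissible H → Superlinearly4Choosable H)

-- A minimum counterexample G is connected: otherwise the vertices reachable from some vertex form
-- a set closed under adjacency that splits G into two smaller admissible graphs, and their
-- colourings combine. It has no vertex of degree 0 (G would be a single vertex) or 1: deleting a
-- pendant vertex v leaves an admissible graph, unless the component of the neighbour u is a C₅, in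
-- which case G is C₅ with a pendant edge and is coloured directly; otherwise v receives a colour
-- avoiding the at most three colours on u and its other neighbours. Finally, a cycle of length
-- other than 5 has a list colouring of its square from lists of size 4 (found greedily after
-- rotating the cycle, or by repeating one colour), and such a colouring is superlinear, while C₅
-- itself is excluded as a component.

module Submission where

open import Defs
open import Data.Nat using (ℕ; zero; suc; _+_; _∸_; _≤_; _<_; z≤n; s≤s; _%_; _≡ᵇ_; _≟_; _<?_)
open import Data.Nat.Properties
  using (≤-refl; ≤-trans; ≤-antisym; <-trans; <-irrefl; 1+n≰n; n<1+n; n≤1+n; suc-injective; ≤∧≢⇒<; <⇒≢; m<n+m;
         m∸n+n≡m; ≡⇒≡ᵇ; ≡ᵇ⇒≡)
open import Data.Nat.DivMod using (m<n⇒m%n≡m; n%n≡0; m%n<n)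
open import Data.Bool using (Bool; true; false; T; not; _∧_; _∨_)
open import Data.Bool.ListAction using (any; or)
open import Data.Bool.Properties using (T?; T-≡; T-∧; T-∨; T-not-≡; ¬-not; ∨-comm)
import Data.Bool.Properties as Boolₚ
open import Data.Fin using (Fin; zero; suc; #_; toℕ; fromℕ<; _↑ˡ_; splitAt; punchIn; punchOut)
open import Data.Fin.Properties
  using (all?; any?; toℕ-injective; toℕ<n; toℕ-fromℕ<; fromℕ<-toℕ; punchIn-injective; punchInᵢ≢i;
         punchIn-punchOut; splitAt-↑ˡ; splitAt⁻¹-↑ˡ; splitAt⁻¹-↑ʳ)
  renaming (_≟_ to _≟ᶠ_)
open import Data.List using (List; []; _∷_; length; map; filterᵇ; allFin; lookup)
open import Data.List.Properties using (length-map; length-tabulate; filter-notAll; map-cong)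
open import Data.List.Membership.Propositional using (_∈_)
open import Data.List.Membership.Propositional.Properties
  using (∈-filter⁺; ∈-filter⁻; ∈-allFin; ∈-lookup; ∈-map⁺; ∈-map⁻)
open import Data.List.Membership.DecPropositional _≟_ using (_∈?_)
open import Data.List.Relation.Unary.Any as Any using (here; there)
open import Data.List.Relation.Unary.Any.Properties using (any⁺; any⁻; lookup-index)
open import Data.List.Relation.Unary.All as All using (All; []; _∷_)
open import Data.List.Relation.Unary.AllPairs using ([]; _∷_)
open import Data.List.Relation.Unary.Unique.Propositional using (Unique)
import Data.List.Relation.Unary.Unique.Propositional.Properties as Unique
open import Data.Product using (Σ; ∃; _×_; _,_; proj₁; proj₂)
open import Data.Sum using (_⊎_; inj₁; inj₂; [_,_]′)
import Data.Sum as Sum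
open import Data.Empty using (⊥; ⊥-elim)
open import Function.Bundles using (Equivalence; Inverse)
open import Function.Definitions using (Injective)
open import Relation.Nullary using (¬_; yes; no)
open import Relation.Nullary.Decidable using (⌊_⌋; toWitness; _×-dec_; _→-dec_)
open import Relation.Binary.PropositionalEquality
  using (_≡_; _≢_; refl; sym; trans; cong; cong₂; subst; subst₂; ≢-sym)

remove : ∀ {A : Set} {x : A} (ys : List A) → x ∈ ys → List A
remove (_ ∷ ys) (here _)  = ys
remove (y ∷ ys) (there p) = y ∷ remove ys p

length-remove : ∀ {A : Set} {x : A} (ys : List A) (p : x ∈ ys) → suc (length (remove ys p)) ≡ length ys
length-remove (_ ∷ ys) (here _)  = refl
length-remove (_ ∷ ys) (there p) = cong suc (length-remove ys p)

∈-remove : ∀ {A : Set} {x y : A} (ys : List A) (p : x ∈ ys) → y ∈ ys → y ≢ x → y ∈ remove ys p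
∈-remove (_ ∷ _)  (here x≡a) (here y≡a) y≢x = ⊥-elim (y≢x (trans y≡a (sym x≡a)))
∈-remove (_ ∷ _)  (there _)  (here y≡a) _   = here y≡a
∈-remove (_ ∷ _)  (here _)   (there q)  _   = q
∈-remove (_ ∷ ys) (there p)  (there q)  y≢x = there (∈-remove ys p q y≢x)

unique-⊆-length-≤ : ∀ {A : Set} (xs ys : List A) → Unique xs → (∀ {z} → z ∈ xs → z ∈ ys) →
  length xs ≤ length ys
unique-⊆-length-≤ []       ys _          _   = z≤n
unique-⊆-length-≤ (x ∷ xs) ys (x∉xs ∷ u) xs⊆ys =
  subst (suc (length xs) ≤_) (length-remove ys x∈ys)
    (s≤s (unique-⊆-length-≤ xs (remove ys x∈ys) u
      (λ z∈xs → ∈-remove ys x∈ys (xs⊆ys (there z∈xs)) (λ z≡x → All.lookup x∉xs z∈xs (sym z≡x)))))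
  where
  x∈ys : x ∈ ys
  x∈ys = xs⊆ys (here refl)

module _ {n : ℕ} where
  open import Data.List.Membership.DecPropositional (_≟ᶠ_ {n}) using () renaming (_∈?_ to _∈ᶠ?_)

  unique-⊆-exhausts : (xs ys : List (Fin n)) → Unique xs → (∀ {z} → z ∈ xs → z ∈ ys) →
    length ys ≤ length xs → ∀ {w} → w ∈ ys → w ∈ xs
  unique-⊆-exhausts xs ys u xs⊆ys ys≤xs {w} w∈ys with w ∈ᶠ? xs
  ... | yes w∈xs = w∈xs
  ... | no  w∉xs = ⊥-elim (<-irrefl refl (≤-trans xs<ys ys≤xs))
    where
    xs<ys : length xs < length ys
    xs<ys = subst (suc (length xs) ≤_) (length-remove ys w∈ys) (s≤s (unique-⊆-length-≤ xs (remove ys w∈ys) u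
      (λ z∈xs → ∈-remove ys w∈ys (xs⊆ys z∈xs) (λ z≡w → w∉xs (subst (_∈ xs) z≡w z∈xs)))))

FourList : List ℕ → Set
FourList l = Unique l × length l ≡ 4

pick : List ℕ → List ℕ → ℕ
pick []      _   = 0
pick (x ∷ l) bad with x ∈? bad
... | yes _ = pick l bad
... | no  _ = x

pick-spec : ∀ l bad → (∀ {x} → x ∈ l → x ∈ bad) ⊎ (pick l bad ∈ l × ¬ pick l bad ∈ bad)
pick-spec []      bad = inj₁ (λ ())
pick-spec (x ∷ l) bad with x ∈? bad
... | no x∉bad = inj₂ (here refl , x∉bad)
... | yes x∈bad with pick-spec l bad
...   | inj₁ l⊆bad          = inj₁ λ { (here refl) → x∈bad ; (there q) → l⊆bad q }
...   | inj₂ (p∈l , p∉bad) = inj₂ (there p∈l , p∉bad)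

module _ {l bad : List ℕ} (four : FourList l) (few : length bad ≤ 3) where

  pick-fresh : pick l bad ∈ l × ¬ pick l bad ∈ bad
  pick-fresh with pick-spec l bad
  ... | inj₂ fresh = fresh
  ... | inj₁ l⊆bad = ⊥-elim (1+n≰n (≤-trans (subst (_≤ length bad) (proj₂ four)
                       (unique-⊆-length-≤ l bad (proj₁ four) l⊆bad)) few))

  pick-∈ : pick l bad ∈ l
  pick-∈ = proj₁ pick-fresh

  pick-≢ : ∀ {c} → c ∈ bad → pick l bad ≢ c
  pick-≢ c∈bad refl = proj₂ pick-fresh c∈bad

T⇒≡true : ∀ {b} → T b → b ≡ true
T⇒≡true = Equivalence.to T-≡

≡true⇒T : ∀ {b} → b ≡ true → T b
≡true⇒T = Equivalence.from T-≡

module _ {n : ℕ} (G : Graph n) where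

  nbrs : Fin n → List (Fin n)
  nbrs v = filterᵇ (G v) (allFin n)

  ∈-nbrs⁺ : ∀ {v x} → G v x ≡ true → x ∈ nbrs v
  ∈-nbrs⁺ {v} {x} e = ∈-filter⁺ (λ y → T? (G v y)) (∈-allFin x) (≡true⇒T e)

  ∈-nbrs⁻ : ∀ {v x} → x ∈ nbrs v → G v x ≡ true
  ∈-nbrs⁻ {v} x∈ = T⇒≡true (proj₂ (∈-filter⁻ (λ y → T? (G v y)) {xs = allFin n} x∈))

  nbrs-unique : ∀ v → Unique (nbrs v)
  nbrs-unique v = Unique.filter⁺ (λ y → T? (G v y)) (Unique.allFin⁺ n)

  deg-≥ : ∀ v (zs : List (Fin n)) → Unique zs → (∀ {z} → z ∈ zs → G v z ≡ true) → length zs ≤ deg G v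
  deg-≥ v zs u adj = unique-⊆-length-≤ zs (nbrs v) u (λ z∈ → ∈-nbrs⁺ (adj z∈))

  deg-≤ : ∀ v (zs : List (Fin n)) → (∀ z → G v z ≡ true → z ∈ zs) → deg G v ≤ length zs
  deg-≤ v zs cover = unique-⊆-length-≤ (nbrs v) zs (nbrs-unique v) (λ z∈ → cover _ (∈-nbrs⁻ z∈))

  deg-≥2 : ∀ v {x y} → G v x ≡ true → G v y ≡ true → x ≢ y → 2 ≤ deg G v
  deg-≥2 v ex ey x≢y = deg-≥ v _ ((x≢y ∷ []) ∷ [] ∷ [])
    λ { (here refl) → ex ; (there (here refl)) → ey }

  deg-≥3 : ∀ v {x y z} → G v x ≡ true → G v y ≡ true → G v z ≡ true → x ≢ y → x ≢ z → y ≢ z →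
    3 ≤ deg G v
  deg-≥3 v ex ey ez x≢y x≢z y≢z = deg-≥ v _ ((x≢y ∷ x≢z ∷ []) ∷ (y≢z ∷ []) ∷ [] ∷ [])
    λ { (here refl) → ex ; (there (here refl)) → ey ; (there (there (here refl))) → ez }

  deg-≥4 : ∀ v {x y z w} → G v x ≡ true → G v y ≡ true → G v z ≡ true → G v w ≡ true →
    x ≢ y → x ≢ z → x ≢ w → y ≢ z → y ≢ w → z ≢ w → 4 ≤ deg G v
  deg-≥4 v ex ey ez ew x≢y x≢z x≢w y≢z y≢w z≢w =
    deg-≥ v _ ((x≢y ∷ x≢z ∷ x≢w ∷ []) ∷ (y≢z ∷ y≢w ∷ []) ∷ (z≢w ∷ []) ∷ [] ∷ [])
      λ { (here refl) → ex ; (there (here refl)) → ey ; (there (there (here refl))) → ez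
        ; (there (there (there (here refl)))) → ew }

  deg≡1⇒unique-nbr : ∀ v → deg G v ≡ 1 →
    Σ (Fin n) λ u → G v u ≡ true × (∀ x → G v x ≡ true → x ≡ u)
  deg≡1⇒unique-nbr v d with nbrs v | ∈-nbrs⁺ {v} | ∈-nbrs⁻ {v}
  ... | u ∷ [] | ∈⁺ | ∈⁻ = u , ∈⁻ (here refl) , λ x e → single (∈⁺ e)
    where single : ∀ {x} → x ∈ u ∷ [] → x ≡ u
          single (here x≡u) = x≡u

-- Rainbow colourings

Proper : ∀ {n} → Graph n → (Fin n → ℕ) → Set
Proper G f = ∀ u v → G u v ≡ true → f u ≢ f v

Rainbow : ∀ {n} → Graph n → (Fin n → ℕ) → Fin n → Set
Rainbow G f w = ∀ x y → G w x ≡ true → G w y ≡ true → x ≢ y → f x ≢ f y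

NoThreeAlike : ∀ {n} → Graph n → (Fin n → ℕ) → Fin n → Set
NoThreeAlike G f w = ∀ x y z → G w x ≡ true → G w y ≡ true → G w z ≡ true →
  x ≢ y → y ≢ z → x ≢ z → f x ≡ f y → f y ≡ f z → ⊥

Rainbow⇒NoThreeAlike : ∀ {n} (G : Graph n) f w → Rainbow G f w → NoThreeAlike G f w
Rainbow⇒NoThreeAlike G f w rb x y _ ex ey _ x≢y _ _ fx≡fy _ = rb x y ex ey x≢y fx≡fy

two-colours : ∀ {a b p q r : ℕ} → p ≡ a ⊎ p ≡ b → q ≡ a ⊎ q ≡ b → r ≡ a ⊎ r ≡ b →
  q ≢ p → r ≢ p → q ≡ r
two-colours (inj₁ refl) (inj₁ refl) _           q≢p _   = ⊥-elim (q≢p refl)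
two-colours (inj₁ refl) (inj₂ refl) (inj₁ refl) _   r≢p = ⊥-elim (r≢p refl)
two-colours (inj₁ refl) (inj₂ refl) (inj₂ refl) _   _   = refl
two-colours (inj₂ refl) (inj₂ refl) _           q≢p _   = ⊥-elim (q≢p refl)
two-colours (inj₂ refl) (inj₁ refl) (inj₂ refl) _   r≢p = ⊥-elim (r≢p refl)
two-colours (inj₂ refl) (inj₁ refl) (inj₁ refl) _   _   = refl

cycleGraph-sym : ∀ m i j → cycleGraph m i j ≡ cycleGraph m j i
cycleGraph-sym m i j = ∨-comm (toℕ j ≡ᵇ suc (toℕ i) % (3 + m)) (toℕ i ≡ᵇ suc (toℕ j) % (3 + m))

i₀ i₁ i₂ : ∀ {m} → Fin (3 + m)
i₀ = zero
i₁ = suc zero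
i₂ = suc (suc zero)

i₀≢i₂ : ∀ {m} → i₀ {m} ≢ i₂
i₀≢i₂ ()

third-on-cycle : ∀ m → Σ (Fin (3 + m)) λ t → t ≢ i₁ × cycleGraph m i₂ t ≡ true
third-on-cycle zero    = zero , (λ ()) , refl
third-on-cycle (suc m) = suc (suc (suc zero)) , (λ ()) , refl

module _ {n} (G : Graph n) (f : Fin n → ℕ) (proper : Proper G f) where

  -- A vertex of a two-coloured cycle sees its two cycle neighbours in the same colour, so
  -- an edge with a rainbow endpoint cannot lie on such a cycle.
  linear-of-rainbow-edges : (∀ w → NoThreeAlike G f w) →
    (∀ u v → G u v ≡ true → Rainbow G f u ⊎ Rainbow G f v) → Linear G f
  linear-of-rainbow-edges noThree rainbowEdge a b = maxDeg , noCycle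
    where
    S : Fin n → Set
    S v = f v ≡ a ⊎ f v ≡ b

    alike : ∀ {v x y} → S v → S x → S y → G v x ≡ true → G v y ≡ true → f x ≡ f y
    alike sv sx sy ex ey =
      two-colours sv sx sy (λ e → proper _ _ ex (sym e)) (λ e → proper _ _ ey (sym e))

    maxDeg : MaxDeg≤2On G S
    maxDeg v x y z sv sx sy sz ex ey ez x≢y y≢z x≢z =
      noThree v x y z ex ey ez x≢y y≢z x≢z (alike sv sx sy ex ey) (alike sv sy sz ey ez)

    noCycle : ¬ HasCycleOn G S
    noCycle (m , c , inj , inS , edge) with third-on-cycle m | rainbowEdge _ _ (edge i₁ i₂ refl)
    ... | _ , _ , _ | inj₁ rb =
      rb (c i₀) (c i₂) (edge i₁ i₀ refl) (edge i₁ i₂ refl) (λ e → i₀≢i₂ (inj e))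
        (alike (inS i₁) (inS i₀) (inS i₂) (edge i₁ i₀ refl) (edge i₁ i₂ refl))
    ... | t , t≢i₁ , e2t | inj₂ rb = let e21 = trans (cycleGraph-sym m i₂ i₁) refl in
      rb (c i₁) (c t) (edge i₂ i₁ e21) (edge i₂ t e2t) (λ e → t≢i₁ (sym (inj e)))
        (alike (inS i₂) (inS i₁) (inS t) (edge i₂ i₁ e21) (edge i₂ t e2t))

RainbowEdged : ∀ {n} → Graph n → (Fin n → ℕ) → Set
RainbowEdged G f = Proper G f × (∀ w → NoThreeAlike G f w)
  × (∀ u v → G u v ≡ true → Rainbow G f u ⊎ Rainbow G f v)

superlinear-of-rainbowEdged : ∀ {n} (G : Graph n) (L : ListAssignment n) (f : Fin n → ℕ) →
  (∀ v → f v ∈ L v) → RainbowEdged G f → (∀ w → deg G w ≡ 2 → Rainbow G f w) →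
  SuperlinearLColoring G L f
superlinear-of-rainbowEdged G L f f∈L (proper , noThree , rainbowEdge) deg2 =
  (f∈L , proper) , linear-of-rainbow-edges G f proper noThree rainbowEdge ,
  λ v x y dv → deg2 v dv x y

module _ {n k} (G : Graph n) (H : Graph k) (to : Fin n → Fin k)
         (to-inj : ∀ {a b} → to a ≡ to b → a ≡ b)
         (hom : ∀ u v → G u v ≡ true → H (to u) (to v) ≡ true) (g : Fin k → ℕ) where

  rainbow-pullback : ∀ w → Rainbow H g (to w) → Rainbow G (λ v → g (to v)) w
  rainbow-pullback w rb x y ex ey x≢y = rb (to x) (to y) (hom w x ex) (hom w y ey) (λ e → x≢y (to-inj e))

  rainbowEdged-pullback : RainbowEdged H g → RainbowEdged G (λ v → g (to v))
  rainbowEdged-pullback (proper , noThree , rainbowEdge) =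
    (λ u v e → proper (to u) (to v) (hom u v e)) ,
    (λ w x y z ex ey ez x≢y y≢z x≢z → noThree (to w) (to x) (to y) (to z) (hom w x ex) (hom w y ey) (hom w z ez)
      (λ e → x≢y (to-inj e)) (λ e → y≢z (to-inj e)) (λ e → x≢z (to-inj e))) ,
    λ u v e → Sum.map (rainbow-pullback u) (rainbow-pullback v) (rainbowEdge (to u) (to v) (hom u v e))

superlinear-pullback : ∀ {n k} (G : Graph n) (H : Graph k) (to : Fin n → Fin k) (from : Fin k → Fin n) →
  (∀ w → from (to w) ≡ w) → (∀ u v → G u v ≡ true → H (to u) (to v) ≡ true) →
  (L : ListAssignment n) (g : Fin k → ℕ) → (∀ j → g j ∈ L (from j)) → RainbowEdged H g →
  (∀ w → deg G w ≡ 2 → Rainbow H g (to w)) → SuperlinearlyColorable G L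
superlinear-pullback G H to from from-to hom L g g∈L rainbowEdged deg2 =
  (λ w → g (to w)) ,
  superlinear-of-rainbowEdged G L (λ w → g (to w))
    (λ v → subst (λ u → g (to v) ∈ L u) (from-to v) (g∈L (to v)))
    (rainbowEdged-pullback G H to to-inj hom g rainbowEdged)
    (λ w dw → rainbow-pullback G H to to-inj hom g w (deg2 w dw))
  where
  to-inj : ∀ {a b} → to a ≡ to b → a ≡ b
  to-inj {a} {b} e = trans (sym (from-to a)) (trans (cong from e) (from-to b))

module _ {k} (H : Graph k) (g : Fin k → ℕ) (j : Fin k) where

  rainbow-of-one-nbr : ∀ p → (∀ x → H j x ≡ true → x ≡ p) → Rainbow H g j
  rainbow-of-one-nbr p nbr x y ex ey x≢y = ⊥-elim (x≢y (trans (nbr x ex) (sym (nbr y ey))))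

  rainbow-of-two-nbrs : ∀ p q → (∀ x → H j x ≡ true → x ∈ p ∷ q ∷ []) → g p ≢ g q → Rainbow H g j
  rainbow-of-two-nbrs p q nbr gp≢gq x y ex ey x≢y gx≡gy =
    gp≢gq (trans (same (here refl)) (sym (same (there (here refl)))))
    where
    alike : ∀ {w} → w ∈ x ∷ y ∷ [] → g w ≡ g x
    alike (here refl)         = refl
    alike (there (here refl)) = sym gx≡gy
    same : ∀ {w} → w ∈ p ∷ q ∷ [] → g w ≡ g x
    same w∈ = alike (unique-⊆-exhausts (x ∷ y ∷ []) (p ∷ q ∷ []) ((x≢y ∷ []) ∷ [] ∷ [])
      (λ { (here refl) → nbr x ex ; (there (here refl)) → nbr y ey }) (s≤s (s≤s z≤n)) w∈)

  noThreeAlike-of-three-nbrs : ∀ p q r → (∀ x → H j x ≡ true → x ∈ p ∷ q ∷ r ∷ []) → g p ≢ g r →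
    NoThreeAlike H g j
  noThreeAlike-of-three-nbrs p q r nbr gp≢gr x y z ex ey ez x≢y y≢z x≢z gx≡gy gy≡gz =
    gp≢gr (trans (same (here refl)) (sym (same (there (there (here refl))))))
    where
    alike : ∀ {w} → w ∈ x ∷ y ∷ z ∷ [] → g w ≡ g x
    alike (here refl)                 = refl
    alike (there (here refl))         = sym gx≡gy
    alike (there (there (here refl))) = sym (trans gx≡gy gy≡gz)
    same : ∀ {w} → w ∈ p ∷ q ∷ r ∷ [] → g w ≡ g x
    same w∈ = alike (unique-⊆-exhausts (x ∷ y ∷ z ∷ []) (p ∷ q ∷ r ∷ [])
      ((x≢y ∷ x≢z ∷ []) ∷ (y≢z ∷ []) ∷ [] ∷ [])
      (λ { (here refl) → nbr x ex ; (there (here refl)) → nbr y ey ; (there (there (here refl))) → nbr z ez })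
      (s≤s (s≤s (s≤s z≤n))) w∈)

-- Squares of cycles

next : ℕ → ℕ → ℕ
next m p = suc p % (3 + m)

prev : ℕ → ℕ → ℕ
prev m zero    = suc (suc m)
prev m (suc p) = p

next-cases : ∀ m p → p < 3 + m → (suc p < 3 + m × next m p ≡ suc p) ⊎ (suc p ≡ 3 + m × next m p ≡ 0)
next-cases m p p<k with suc p ≟ 3 + m
... | yes p+1≡k = inj₂ (p+1≡k , trans (cong (_% (3 + m)) p+1≡k) (n%n≡0 (3 + m)))
... | no  p+1≢k = let p+1<k = ≤∧≢⇒< p<k p+1≢k in inj₁ (p+1<k , m<n⇒m%n≡m p+1<k)

next< : ∀ m p → next m p < 3 + m
next< m p = m%n<n (suc p) (3 + m)

prev< : ∀ m p → p < 3 + m → prev m p < 3 + m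
prev< m zero    _   = ≤-refl
prev< m (suc p) p<k = <-trans (n<1+n p) p<k

next-injective : ∀ m a b → a < 3 + m → b < 3 + m → next m a ≡ next m b → a ≡ b
next-injective m a b a<k b<k e with next-cases m a a<k | next-cases m b b<k
... | inj₁ (_ , ea) | inj₁ (_ , eb) = suc-injective (trans (sym ea) (trans e eb))
... | inj₂ (ka , _) | inj₂ (kb , _) = suc-injective (trans ka (sym kb))
... | inj₁ (_ , ea) | inj₂ (_ , eb) with () ← trans (sym ea) (trans e eb)
... | inj₂ (_ , ea) | inj₁ (_ , eb) with () ← trans (sym eb) (trans (sym e) ea)

prev-next : ∀ m p → p < 3 + m → prev m (next m p) ≡ p
prev-next m p p<k with next-cases m p p<k
... | inj₁ (_ , e) rewrite e = refl
... | inj₂ (k , e) rewrite e = suc-injective (sym k)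

next-prev : ∀ m p → p < 3 + m → next m (prev m p) ≡ p
next-prev m zero    _   = n%n≡0 (3 + m)
next-prev m (suc p) p<k = m<n⇒m%n≡m p<k

next≢prev : ∀ m p → p < 3 + m → next m p ≢ prev m p
next≢prev m p p<k with next-cases m p p<k
next≢prev m zero    _ | inj₁ (_ , e) = λ e′ → 1≢2+m (trans (sym e) e′)
  where 1≢2+m : 1 ≢ suc (suc m)
        1≢2+m ()
next≢prev m (suc p) _ | inj₁ (_ , e) = λ e′ → <⇒≢ (<-trans (n<1+n p) (n<1+n (suc p))) (sym (trans (sym e) e′))
next≢prev m p       _ | inj₂ (k , e) rewrite suc-injective k = λ e′ → 0≢1+m (trans (sym e) e′)
  where 0≢1+m : 0 ≢ suc m
        0≢1+m ()

module _ (m : ℕ) where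

  cycleGraph-intro : ∀ i j → toℕ j ≡ next m (toℕ i) → cycleGraph m i j ≡ true
  cycleGraph-intro i j e = subst (λ b → b ∨ (toℕ i ≡ᵇ next m (toℕ j)) ≡ true)
    (sym (T⇒≡true (≡⇒≡ᵇ _ _ e))) refl

  cycleGraph-elim : ∀ i j → cycleGraph m i j ≡ true → toℕ j ≡ next m (toℕ i) ⊎ toℕ i ≡ next m (toℕ j)
  cycleGraph-elim i j e with toℕ j ≡ᵇ next m (toℕ i) in e₁
  ... | true  = inj₁ (≡ᵇ⇒≡ _ _ (≡true⇒T e₁))
  ... | false = inj₂ (≡ᵇ⇒≡ _ _ (≡true⇒T e))

  cycleGraph-step : ∀ t (t<k : t < 3 + m) (t+1<k : suc t < 3 + m) →
    cycleGraph m (fromℕ< t<k) (fromℕ< t+1<k) ≡ true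
  cycleGraph-step t t<k t+1<k = cycleGraph-intro (fromℕ< t<k) (fromℕ< t+1<k)
    (trans (toℕ-fromℕ< t+1<k) (sym (trans (cong (next m) (toℕ-fromℕ< t<k)) (m<n⇒m%n≡m t+1<k))))

  cycleGraph-two-nbrs : ∀ i → Σ (Fin (3 + m)) λ j → Σ (Fin (3 + m)) λ j′ →
    cycleGraph m i j ≡ true × cycleGraph m i j′ ≡ true × j ≢ j′
  cycleGraph-two-nbrs i = j , j′ ,
    cycleGraph-intro i j (toℕ-fromℕ< (next< m t)) ,
    trans (cycleGraph-sym m i j′) (cycleGraph-intro j′ i
      (sym (trans (cong (next m) (toℕ-fromℕ< (prev< m t t<k))) (next-prev m t t<k)))) ,
    λ e → next≢prev m t t<k (trans (sym (toℕ-fromℕ< (next< m t)))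
            (trans (cong toℕ e) (toℕ-fromℕ< (prev< m t t<k))))
    where
    t : ℕ
    t = toℕ i
    t<k : t < 3 + m
    t<k = toℕ<n i
    j j′ : Fin (3 + m)
    j = fromℕ< (next< m t)
    j′ = fromℕ< (prev< m t t<k)

DiffersAlong : ℕ → (ℕ → ℕ) → (ℕ → ℕ) → Set
DiffersAlong m h shift = ∀ p → p < 3 + m → h p ≢ h (shift p)

SquareColouring : ℕ → (ℕ → List ℕ) → Set
SquareColouring m Lp = Σ (ℕ → ℕ) λ h → (∀ p → p < 3 + m → h p ∈ Lp p)
  × DiffersAlong m h (next m) × DiffersAlong m h (λ p → next m (next m p))

square-colouring-of-path : ∀ m (h : ℕ → ℕ) →
  (∀ a → suc a < 3 + m → h a ≢ h (suc a)) → (∀ a → 2 + a < 3 + m → h a ≢ h (2 + a)) →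
  h (2 + m) ≢ h 0 → h (1 + m) ≢ h 0 → h (2 + m) ≢ h 1 →
  DiffersAlong m h (next m) × DiffersAlong m h (λ p → next m (next m p))
square-colouring-of-path m h step1 step2 last≢0 last-1≢0 last≢1 = differs1 , differs2
  where
  differs1 : DiffersAlong m h (next m)
  differs1 p p<k with next-cases m p p<k
  ... | inj₁ (p+1<k , e) rewrite e = step1 p p+1<k
  ... | inj₂ (p+1≡k , e) rewrite e | suc-injective p+1≡k = last≢0
  differs2 : DiffersAlong m h (λ p → next m (next m p))
  differs2 p p<k with next-cases m p p<k
  ... | inj₂ (p+1≡k , e) rewrite e | suc-injective p+1≡k = last≢1
  ... | inj₁ (p+1<k , e) rewrite e with next-cases m (suc p) p+1<k
  ...   | inj₁ (p+2<k , e′) rewrite e′ = step2 p p+2<k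
  ...   | inj₂ (p+2≡k , e′) rewrite e′ | suc-injective (suc-injective p+2≡k) = last-1≢0

rotate-square-colouring : ∀ m Lp → SquareColouring m (λ p → Lp (prev m p)) → SquareColouring m Lp
rotate-square-colouring m Lp (h , h∈ , differs1 , differs2) =
  (λ p → h (next m p)) ,
  (λ p p<k → subst (λ q → h (next m p) ∈ Lp q) (prev-next m p p<k) (h∈ (next m p) (next< m p))) ,
  (λ p _ → differs1 (next m p) (next< m p)) ,
  (λ p _ → differs2 (next m p) (next< m p))

module _ (m : ℕ) (h : ℕ → ℕ) where

  private
    g : Fin (3 + m) → ℕ
    g i = h (toℕ i)

  square-proper : DiffersAlong m h (next m) → Proper (cycleGraph m) g
  square-proper differs1 i j e with cycleGraph-elim m i j e
  ... | inj₁ j≡i+1 = λ q → differs1 (toℕ i) (toℕ<n i) (trans q (cong h j≡i+1))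
  ... | inj₂ i≡j+1 = λ q → differs1 (toℕ j) (toℕ<n j) (trans (sym q) (cong h i≡j+1))

  square-rainbow : DiffersAlong m h (λ p → next m (next m p)) → ∀ v → Rainbow (cycleGraph m) g v
  square-rainbow differs2 v x y ex ey x≢y with cycleGraph-elim m v x ex | cycleGraph-elim m v y ey
  ... | inj₁ a | inj₁ b = ⊥-elim (x≢y (toℕ-injective (trans a (sym b))))
  ... | inj₂ a | inj₂ b =
    ⊥-elim (x≢y (toℕ-injective (next-injective m _ _ (toℕ<n x) (toℕ<n y) (trans (sym a) b))))
  ... | inj₁ a | inj₂ b = λ q → differs2 (toℕ y) (toℕ<n y) (trans (sym q) (cong h (trans a (cong (next m) b))))
  ... | inj₂ a | inj₁ b = λ q → differs2 (toℕ x) (toℕ<n x) (trans q (cong h (trans b (cong (next m) a))))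

constraintsAt : List (ℕ × ℕ) → ℕ → List ℕ
constraintsAt []             p = []
constraintsAt ((q , a) ∷ cs) p with p ≟ q
... | yes _ = a ∷ constraintsAt cs p
... | no  _ = constraintsAt cs p

∈-constraintsAt : ∀ {q a} cs → (q , a) ∈ cs → a ∈ constraintsAt cs q
∈-constraintsAt {q} ((q′ , a′) ∷ cs) q,a∈ with q ≟ q′ | q,a∈
... | yes _   | here refl = here refl
... | yes _   | there q,a∈cs = there (∈-constraintsAt cs q,a∈cs)
... | no  q≢q | here refl = ⊥-elim (q≢q refl)
... | no  _   | there q,a∈cs = ∈-constraintsAt cs q,a∈cs

constraintsAt-≢ : ∀ p cs → All (p ≢_) (map proj₁ cs) → constraintsAt cs p ≡ []
constraintsAt-≢ p []             []              = refl
constraintsAt-≢ p ((q , _) ∷ cs) (p≢q ∷ p≢cs) with p ≟ q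
... | yes p≡q = ⊥-elim (p≢q p≡q)
... | no  _   = constraintsAt-≢ p cs p≢cs

length-constraintsAt : ∀ p cs → Unique (map proj₁ cs) → length (constraintsAt cs p) ≤ 1
length-constraintsAt p []             _             = z≤n
length-constraintsAt p ((q , _) ∷ cs) (q∉cs ∷ uniq) with p ≟ q
... | yes refl rewrite constraintsAt-≢ p cs q∉cs = ≤-refl
... | no  _    = length-constraintsAt p cs uniq

module Greedy (c : ℕ) (C X : ℕ → List ℕ) where

  mutual
    colour : ℕ → ℕ
    colour zero    = c
    colour (suc p) = pick (C (suc p)) (forbidden (suc p))

    forbidden : ℕ → List ℕ
    forbidden zero          = []
    forbidden (suc zero)    = c ∷ []
    forbidden (suc (suc p)) = colour (suc p) ∷ colour p ∷ X (2 + p)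

  length-forbidden : ∀ p → length (X p) ≤ 1 → length (forbidden p) ≤ 3
  length-forbidden zero          _  = z≤n
  length-forbidden (suc zero)    _  = s≤s z≤n
  length-forbidden (suc (suc p)) lx = s≤s (s≤s lx)

  Fresh : ℕ → Set
  Fresh p = ¬ colour p ∈ forbidden p

  module _ {p} (four : FourList (C (suc p))) (lx : length (X (suc p)) ≤ 1) where

    colour-∈ : colour (suc p) ∈ C (suc p)
    colour-∈ = pick-∈ four (length-forbidden (suc p) lx)

    colour-fresh : Fresh (suc p)
    colour-fresh = proj₂ (pick-fresh four (length-forbidden (suc p) lx))

  colour-≢-next : ∀ a → Fresh (suc a) → colour a ≢ colour (suc a)
  colour-≢-next zero    fresh e = fresh (here (sym e))
  colour-≢-next (suc a) fresh e = fresh (here (sym e))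

  colour-≢-next₂ : ∀ a → Fresh (2 + a) → colour a ≢ colour (2 + a)
  colour-≢-next₂ a fresh e = fresh (there (here (sym e)))

  colour-avoids-start : ∀ p → Fresh (suc p) → c ∈ X (suc p) → colour (suc p) ≢ c
  colour-avoids-start zero    fresh _  e = fresh (here e)
  colour-avoids-start (suc p) fresh c∈ e = fresh (there (there (subst (_∈ X (2 + p)) (sym e) c∈)))

  colour-∉-X : ∀ p → Fresh (2 + p) → ∀ {x} → x ∈ X (2 + p) → colour (2 + p) ≢ x
  colour-∉-X p fresh x∈ refl = fresh (there (there x∈))

  greedy-square-colouring : ∀ m Lp → (∀ p → p < 3 + m → colour p ∈ Lp p) →
    (∀ p → suc p < 3 + m → Fresh (suc p)) →
    colour (2 + m) ≢ c → colour (1 + m) ≢ c → colour (2 + m) ≢ colour 1 → SquareColouring m Lp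
  greedy-square-colouring m Lp colour-∈′ fresh last≢0 last-1≢0 last≢1 =
    colour , colour-∈′ , square-colouring-of-path m colour
      (λ a a+1<k → colour-≢-next a (fresh a a+1<k)) (λ a a+2<k → colour-≢-next₂ a (fresh (suc a) a+2<k))
      last≢0 last-1≢0 last≢1

FourLists : ℕ → (ℕ → List ℕ) → Set
FourLists m Lp = ∀ p → p < 3 + m → FourList (Lp p)

rotate-FourLists : ∀ m Lp → FourLists m Lp → FourLists m (λ p → Lp (prev m p))
rotate-FourLists m Lp four p p<k = four (prev m p) (prev< m p p<k)

-- Greedy along the path 0, 1, …, m + 3 starting with c: position m + 2 must also avoid c and
-- position m + 3 the colour of position 1; c ∉ L(m + 3) takes care of the closing edge.
square-colouring-missing : ∀ m Lp → FourLists (suc m) Lp →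
  ∀ c → c ∈ Lp 0 → ¬ c ∈ Lp (3 + m) → SquareColouring (suc m) Lp
square-colouring-missing m Lp four c c∈ c∉ =
  greedy-square-colouring (suc m) Lp colour-∈′ fresh
    (λ e → c∉ (subst (_∈ Lp (3 + m)) e (colour-∈ (four (3 + m) ≤-refl) (lx (3 + m)))))
    (colour-∉-X m (fresh (suc m) (n≤1+n (3 + m))) (∈-constraintsAt cs (here refl)))
    (colour-∉-X (suc m) (fresh (2 + m) ≤-refl) (∈-constraintsAt cs (there (here refl))))
  where
  cs : List (ℕ × ℕ)
  cs = (2 + m , c) ∷ (3 + m , pick (Lp 1) (c ∷ [])) ∷ []
  open Greedy c Lp (constraintsAt cs)
  lx : ∀ p → length (constraintsAt cs p) ≤ 1
  lx p = length-constraintsAt p cs ((<⇒≢ (n<1+n (2 + m)) ∷ []) ∷ [] ∷ [])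
  fresh : ∀ p → suc p < 4 + m → Fresh (suc p)
  fresh p p+1<k = colour-fresh (four (suc p) p+1<k) (lx (suc p))
  colour-∈′ : ∀ p → p < 4 + m → colour p ∈ Lp p
  colour-∈′ zero    _     = c∈
  colour-∈′ (suc p) p+1<k = colour-∈ (four (suc p) p+1<k) (lx (suc p))

replaceAt : ℕ → List ℕ → (ℕ → List ℕ) → ℕ → List ℕ
replaceAt q xs Lp p with p ≟ q
... | yes _ = xs
... | no  _ = Lp p

replaceAt-here : ∀ q xs Lp → replaceAt q xs Lp q ≡ xs
replaceAt-here q xs Lp with q ≟ q
... | yes _   = refl
... | no  q≢q = ⊥-elim (q≢q refl)

replaceAt-elsewhere : ∀ q xs Lp p → p ≢ q → replaceAt q xs Lp p ≡ Lp p
replaceAt-elsewhere q xs Lp p p≢q with p ≟ q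
... | yes p≡q = ⊥-elim (p≢q p≡q)
... | no  _   = refl

pick-singleton : ∀ {c bad} → ¬ c ∈ bad → pick (c ∷ []) bad ≡ c
pick-singleton {c} {bad} c∉ with c ∈? bad
... | yes c∈ = ⊥-elim (c∉ c∈)
... | no  _  = refl

-- The colour c is used twice, at position 0 and at position r + 3; the positions r + 1 and r + 2
-- before the second copy must avoid c, and the last position that of position 1.
square-colouring-shared : ∀ r Lp → FourLists (3 + r) Lp →
  ∀ c → c ∈ Lp 0 → c ∈ Lp (3 + r) → SquareColouring (3 + r) Lp
square-colouring-shared r Lp four c c∈₀ c∈ =
  greedy-square-colouring (3 + r) Lp colour-∈′ fresh
    (λ e → colour-≢-next₂ (3 + r) (fresh (4 + r) ≤-refl) (trans colour-forced (sym e)))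
    (λ e → colour-≢-next (3 + r) (fresh (3 + r) (n≤1+n (5 + r))) (trans colour-forced (sym e)))
    (colour-∉-X (3 + r) (fresh (4 + r) ≤-refl) (∈-constraintsAt cs (there (there (here refl)))))
  where
  C : ℕ → List ℕ
  C = replaceAt (3 + r) (c ∷ []) Lp

  C-forced : C (3 + r) ≡ c ∷ []
  C-forced = replaceAt-here (3 + r) (c ∷ []) Lp

  C-other : ∀ p → p ≢ 3 + r → C p ≡ Lp p
  C-other p = replaceAt-elsewhere (3 + r) (c ∷ []) Lp p

  cs : List (ℕ × ℕ)
  cs = (1 + r , c) ∷ (2 + r , c) ∷ (5 + r , pick (C 1) (c ∷ [])) ∷ []

  open Greedy c C (constraintsAt cs)

  1+r<2+r : 1 + r < 2 + r
  1+r<2+r = n<1+n (suc r)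
  2+r<3+r : 2 + r < 3 + r
  2+r<3+r = n<1+n (2 + r)
  1+r<5+r : 1 + r < 5 + r
  1+r<5+r = m<n+m (suc r) {4} (s≤s z≤n)
  2+r<5+r : 2 + r < 5 + r
  2+r<5+r = m<n+m (2 + r) {3} (s≤s z≤n)
  3+r<5+r : 3 + r < 5 + r
  3+r<5+r = m<n+m (3 + r) {2} (s≤s z≤n)

  lx : ∀ p → length (constraintsAt cs p) ≤ 1
  lx p = length-constraintsAt p cs
    ((<⇒≢ 1+r<2+r ∷ <⇒≢ 1+r<5+r ∷ []) ∷ (<⇒≢ 2+r<5+r ∷ []) ∷ [] ∷ [])

  X-forced : constraintsAt cs (3 + r) ≡ []
  X-forced = constraintsAt-≢ (3 + r) cs
    ((λ e → <⇒≢ (<-trans 1+r<2+r 2+r<3+r) (sym e)) ∷ (λ e → <⇒≢ 2+r<3+r (sym e)) ∷ <⇒≢ 3+r<5+r ∷ [])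

  fresh-other : ∀ p → suc p ≢ 3 + r → suc p < 6 + r → Fresh (suc p)
  fresh-other p ne p+1<k = colour-fresh {p} (subst FourList (sym (C-other (suc p) ne)) (four (suc p) p+1<k)) (lx (suc p))

  c∉forbidden : ¬ c ∈ forbidden (3 + r)
  c∉forbidden (here e) =
    colour-∉-X r (fresh-other (suc r) (<⇒≢ 2+r<3+r) (<-trans 2+r<3+r (<-trans 3+r<5+r (n<1+n (5 + r)))))
      (∈-constraintsAt cs (there (here refl))) (sym e)
  c∉forbidden (there (here e)) =
    colour-avoids-start r (fresh-other r (<⇒≢ (<-trans 1+r<2+r 2+r<3+r)) (<-trans 1+r<5+r (n<1+n (5 + r))))
      (∈-constraintsAt cs (here refl)) (sym e)
  c∉forbidden (there (there c∈X)) with () ← subst (c ∈_) X-forced c∈X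

  colour-forced : colour (3 + r) ≡ c
  colour-forced = trans (cong (λ l → pick l (forbidden (3 + r))) C-forced) (pick-singleton c∉forbidden)

  -- Testing 3 + r ≟ suc p rather than suc p ≟ 3 + r keeps the with-abstraction from
  -- reaching into the test inside replaceAt.
  fresh : ∀ p → suc p < 6 + r → Fresh (suc p)
  fresh p p+1<k with 3 + r ≟ suc p
  ... | yes e = subst Fresh e λ x → c∉forbidden (subst (_∈ forbidden (3 + r)) colour-forced x)
  ... | no  ne = fresh-other p (λ e → ne (sym e)) p+1<k

  colour-∈′ : ∀ p → p < 6 + r → colour p ∈ Lp p
  colour-∈′ zero    _     = c∈₀
  colour-∈′ (suc p) p+1<k with 3 + r ≟ suc p
  ... | yes e = subst (λ q → colour q ∈ Lp q) e (subst (_∈ Lp (3 + r)) (sym colour-forced) c∈)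
  ... | no  ne = subst (colour (suc p) ∈_) (C-other (suc p) ne′)
                   (colour-∈ {p} (subst FourList (sym (C-other (suc p) ne′)) (four (suc p) p+1<k)) (lx (suc p)))
    where
    ne′ : suc p ≢ 3 + r
    ne′ e = ne (sym e)

square-colouring-triangle : ∀ Lp → FourLists 0 Lp → SquareColouring 0 Lp
square-colouring-triangle Lp four =
  greedy-square-colouring 0 Lp colour-∈′ fresh
    (≢-sym (colour-≢-next₂ 0 (fresh 1 ≤-refl))) (≢-sym (colour-≢-next 0 (fresh 0 (s≤s (s≤s z≤n)))))
    (≢-sym (colour-≢-next 1 (fresh 1 ≤-refl)))
  where
  open Greedy (pick (Lp 0) []) Lp (λ _ → [])
  fresh : ∀ p → suc p < 3 → Fresh (suc p)
  fresh p p+1<k = colour-fresh {p} (four (suc p) p+1<k) z≤n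
  colour-∈′ : ∀ p → p < 3 → colour p ∈ Lp p
  colour-∈′ zero    _     = pick-∈ (four 0 (s≤s z≤n)) z≤n
  colour-∈′ (suc p) p+1<k = colour-∈ {p} (four (suc p) p+1<k) z≤n

square-colouring-square : ∀ Lp → FourLists 1 Lp → SquareColouring 1 Lp
square-colouring-square Lp four =
  greedy-square-colouring 1 Lp colour-∈′ fresh
    (colour-∉-X 1 (fresh 2 ≤-refl) (∈-constraintsAt cs (here refl)))
    (≢-sym (colour-≢-next₂ 0 (fresh 1 (s≤s (s≤s (s≤s z≤n))))))
    (≢-sym (colour-≢-next₂ 1 (fresh 2 ≤-refl)))
  where
  c : ℕ
  c = pick (Lp 0) []
  cs : List (ℕ × ℕ)
  cs = (3 , c) ∷ []
  open Greedy c Lp (constraintsAt cs)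
  lx : ∀ p → length (constraintsAt cs p) ≤ 1
  lx p = length-constraintsAt p cs ([] ∷ [])
  fresh : ∀ p → suc p < 4 → Fresh (suc p)
  fresh p p+1<k = colour-fresh {p} (four (suc p) p+1<k) (lx (suc p))
  colour-∈′ : ∀ p → p < 4 → colour p ∈ Lp p
  colour-∈′ zero    _     = pick-∈ (four 0 (s≤s z≤n)) z≤n
  colour-∈′ (suc p) p+1<k = colour-∈ {p} (four (suc p) p+1<k) (lx (suc p))

-- For a longer cycle pick any c ∈ L(0): either some list among the three preceding positions
-- misses c, and a rotation brings the cycle into the form handled by the greedy colouring, or
-- c is common to all of them and may be used twice.
square-colouring-long : ∀ r Lp → FourLists (3 + r) Lp → SquareColouring (3 + r) Lp
square-colouring-long r Lp four = starting-with (pick (Lp 0) []) (pick-∈ (four 0 (s≤s z≤n)) z≤n)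
  where
  M : ℕ
  M = 3 + r
  starting-with : ∀ c → c ∈ Lp 0 → SquareColouring M Lp
  starting-with c c∈₀ with c ∈? Lp (5 + r)
  ... | no c∉₅ = square-colouring-missing (2 + r) Lp four c c∈₀ c∉₅
  ... | yes c∈₅ with c ∈? Lp (4 + r)
  ...   | no c∉₄ = rotate-square-colouring M Lp
           (square-colouring-missing (2 + r) (λ p → Lp (prev M p)) (rotate-FourLists M Lp four) c c∈₅ c∉₄)
  ...   | yes c∈₄ with c ∈? Lp (3 + r)
  ...     | no c∉₃ = rotate-square-colouring M Lp (rotate-square-colouring M (λ p → Lp (prev M p))
             (square-colouring-missing (2 + r) (λ p → Lp (prev M (prev M p)))
               (rotate-FourLists M _ (rotate-FourLists M Lp four)) c c∈₄ c∉₃))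
  ...     | yes c∈₃ = square-colouring-shared r Lp four c c∈₀ c∈₃

square-colouring : ∀ m → m ≢ 2 → ∀ Lp → FourLists m Lp → SquareColouring m Lp
square-colouring 0               _   = square-colouring-triangle
square-colouring 1               _   = square-colouring-square
square-colouring 2               m≢2 = ⊥-elim (m≢2 refl)
square-colouring (suc (suc (suc r))) _ = square-colouring-long r

-- Lists indexed by positions; positions beyond the cycle get the (irrelevant) empty list.
positionLists : ∀ m → (Fin (3 + m) → List ℕ) → ℕ → List ℕ
positionLists m L p with p <? 3 + m
... | yes p<k = L (fromℕ< p<k)
... | no  _   = []

positionLists-toℕ : ∀ m L (j : Fin (3 + m)) → positionLists m L (toℕ j) ≡ L j
positionLists-toℕ m L j with toℕ j <? 3 + m
... | yes j<k = cong L (fromℕ<-toℕ j j<k)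
... | no  j≮k = ⊥-elim (j≮k (toℕ<n j))

positionLists-four : ∀ m L → (∀ j → FourList (L j)) → FourLists m (positionLists m L)
positionLists-four m L four p p<k with p <? 3 + m
... | yes p<k′ = four (fromℕ< p<k′)
... | no  p≮k  = ⊥-elim (p≮k p<k)

cycle-rainbow-colouring : ∀ m → m ≢ 2 → (L : Fin (3 + m) → List ℕ) → (∀ j → FourList (L j)) →
  Σ (Fin (3 + m) → ℕ) λ g → (∀ j → g j ∈ L j) × Proper (cycleGraph m) g
    × (∀ j → Rainbow (cycleGraph m) g j)
cycle-rainbow-colouring m m≢2 L four with square-colouring m m≢2 (positionLists m L) (positionLists-four m L four)
... | h , h∈ , differs1 , differs2 =
  (λ j → h (toℕ j)) ,
  (λ j → subst (h (toℕ j) ∈_) (positionLists-toℕ m L j) (h∈ (toℕ j) (toℕ<n j))) ,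
  square-proper m h differs1 , square-rainbow m h differs2

cycle-superlinearly-colourable : ∀ {n} (G : Graph n) m → Iso G (cycleGraph m) → m ≢ 2 →
  (L : ListAssignment n) → Size4 L → SuperlinearlyColorable G L
cycle-superlinearly-colourable G m (φ , iso) m≢2 L size4 =
  let g , g∈L , proper , rainbow = cycle-rainbow-colouring m m≢2 (λ j → L (from j)) (λ j → size4 (from j))
  in superlinear-pullback G (cycleGraph m) to from strictlyInverseʳ (λ u v e → trans (iso u v) e) L g g∈L
       (proper , (λ j → Rainbow⇒NoThreeAlike (cycleGraph m) g j (rainbow j)) , (λ i _ _ → inj₁ (rainbow i)))
       (λ w _ → rainbow (to w))
  where open Inverse φ

-- Induced subgraphs

induced : ∀ {m n} → Graph n → (Fin m → Fin n) → Graph m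
induced G e i j = G (e i) (e j)

module Embedded {m n} (G : Graph n) (e : Fin m → Fin n) (e-inj : Injective _≡_ _≡_ e) where

  H : Graph m
  H = induced G e

  Covered : Fin n → Set
  Covered w = ∀ x → G w x ≡ true → ∃ λ a → e a ≡ x

  induced-simple : IsSimple G → IsSimple H
  induced-simple (sym-G , irrefl-G) = (λ i j → sym-G (e i) (e j)) , (λ i → irrefl-G (e i))

  deg-induced-≤ : ∀ i → deg H i ≤ deg G (e i)
  deg-induced-≤ i = subst (_≤ deg G (e i)) (length-map e (nbrs H i))
    (deg-≥ G (e i) (map e (nbrs H i)) (Unique.map⁺ e-inj (nbrs-unique H i)) adjacent)
    where
    adjacent : ∀ {z} → z ∈ map e (nbrs H i) → G (e i) z ≡ true
    adjacent z∈ with ∈-map⁻ e z∈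
    ... | j , j∈ , refl = ∈-nbrs⁻ H j∈

  deg-induced-≥ : ∀ i → Covered (e i) → deg G (e i) ≤ deg H i
  deg-induced-≥ i covered = subst (deg G (e i) ≤_) (length-map e (nbrs H i))
    (deg-≤ G (e i) (map e (nbrs H i)) adjacent)
    where
    adjacent : ∀ z → G (e i) z ≡ true → z ∈ map e (nbrs H i)
    adjacent z ez with covered z ez
    ... | j , refl = ∈-map⁺ e (∈-nbrs⁺ H ez)

  deg-induced-≡ : ∀ i → Covered (e i) → deg H i ≡ deg G (e i)
  deg-induced-≡ i covered = ≤-antisym (deg-induced-≤ i) (deg-induced-≥ i covered)

  induced-subcubic : Subcubic G → Subcubic H
  induced-subcubic subcubic i = ≤-trans (deg-induced-≤ i) (subcubic (e i))

  lift-component : ∀ {k} (K : Graph k) (cp : HasComponentIso H K) → (∀ j → Covered (e (proj₁ cp j))) →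
    HasComponentIso G K
  lift-component K (ψ , ψ-inj , ψ-edge , ψ-closed) covered =
    (λ j → e (ψ j)) , (λ eq → ψ-inj (e-inj eq)) , ψ-edge , closed
    where
    closed : ∀ j w → G (e (ψ j)) w ≡ true → ∃ λ j′ → e (ψ j′) ≡ w
    closed j w ew with covered j w ew
    ... | a , refl with ψ-closed j a ew
    ...   | j′ , refl = j′ , refl

  module Restriction (L : ListAssignment n) (g : Fin m → ℕ) (g-sl : SuperlinearLColoring H (λ i → L (e i)) g)
                     (f : Fin n → ℕ) (f∘e : ∀ i → f (e i) ≡ g i) where

    private
      Class : ℕ → ℕ → Fin n → Set
      Class a b v = f v ≡ a ⊎ f v ≡ b

      class-restrict : ∀ {a b} i → Class a b (e i) → g i ≡ a ⊎ g i ≡ b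
      class-restrict i (inj₁ x) = inj₁ (trans (sym (f∘e i)) x)
      class-restrict i (inj₂ x) = inj₂ (trans (sym (f∘e i)) x)

      f-≡ : ∀ {i j} → f (e i) ≡ f (e j) → g i ≡ g j
      f-≡ {i} {j} eq = trans (sym (f∘e i)) (trans eq (f∘e j))

    f∈L : ∀ i → f (e i) ∈ L (e i)
    f∈L i = subst (_∈ L (e i)) (sym (f∘e i)) (proj₁ (proj₁ g-sl) i)

    f-proper : ∀ i j → G (e i) (e j) ≡ true → f (e i) ≢ f (e j)
    f-proper i j eij eq = proj₂ (proj₁ g-sl) i j eij (f-≡ eq)

    f-deg2 : ∀ i a b → deg H i ≡ 2 → G (e i) (e a) ≡ true → G (e i) (e b) ≡ true → a ≢ b →
      f (e a) ≢ f (e b)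
    f-deg2 i a b di ea eb a≢b eq = proj₂ (proj₂ g-sl) i a b di ea eb a≢b (f-≡ eq)

    f-maxDeg : ∀ {a b} i i₁ i₂ i₃ →
      Class a b (e i) → Class a b (e i₁) → Class a b (e i₂) → Class a b (e i₃) →
      G (e i) (e i₁) ≡ true → G (e i) (e i₂) ≡ true → G (e i) (e i₃) ≡ true →
      e i₁ ≢ e i₂ → e i₂ ≢ e i₃ → e i₁ ≢ e i₃ → ⊥
    f-maxDeg {a} {b} i i₁ i₂ i₃ s s₁ s₂ s₃ e₁ e₂ e₃ n₁₂ n₂₃ n₁₃ =
      proj₁ (proj₁ (proj₂ g-sl) a b) i i₁ i₂ i₃
        (class-restrict i s) (class-restrict i₁ s₁) (class-restrict i₂ s₂) (class-restrict i₃ s₃) e₁ e₂ e₃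
        (λ p → n₁₂ (cong e p)) (λ p → n₂₃ (cong e p)) (λ p → n₁₃ (cong e p))

    f-noCycle : ∀ {a b} (cy : HasCycleOn G (Class a b)) →
      (∀ t → ∃ λ i → e i ≡ proj₁ (proj₂ cy) t) → ⊥
    f-noCycle {a} {b} (k , c , c-inj , inClass , edge) pre =
      proj₂ (proj₁ (proj₂ g-sl) a b) (k , c′ , c′-inj , c′-class , c′-edge)
      where
      c′ : Fin (3 + k) → Fin m
      c′ t = proj₁ (pre t)
      e∘c′ : ∀ t → e (c′ t) ≡ c t
      e∘c′ t = proj₂ (pre t)
      c′-inj : Injective _≡_ _≡_ c′
      c′-inj {s} {t} eq = c-inj (trans (sym (e∘c′ s)) (trans (cong e eq) (e∘c′ t)))
      c′-class : ∀ t → g (c′ t) ≡ a ⊎ g (c′ t) ≡ b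
      c′-class t = class-restrict (c′ t) (subst (Class a b) (sym (e∘c′ t)) (inClass t))
      c′-edge : ∀ s t → cycleGraph k s t ≡ true → H (c′ s) (c′ t) ≡ true
      c′-edge s t st = subst₂ (λ u v → G u v ≡ true) (sym (e∘c′ s)) (sym (e∘c′ t)) (edge s t st)

-- Connectivity

lookup-injective : ∀ {A : Set} (xs : List A) → Unique xs → Injective _≡_ _≡_ (lookup xs)
lookup-injective (x ∷ xs) (x∉xs ∷ u) {zero}  {zero}  _ = refl
lookup-injective (x ∷ xs) (x∉xs ∷ u) {zero}  {suc j} e = ⊥-elim (All.lookup x∉xs (∈-lookup {xs = xs} j) e)
lookup-injective (x ∷ xs) (x∉xs ∷ u) {suc i} {zero}  e = ⊥-elim (All.lookup x∉xs (∈-lookup {xs = xs} i) (sym e))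
lookup-injective (x ∷ xs) (x∉xs ∷ u) {suc i} {suc j} e = cong suc (lookup-injective xs u e)

module Enumeration {n : ℕ} (q : Fin n → Bool) where

  members : List (Fin n)
  members = filterᵇ q (allFin n)

  size : ℕ
  size = length members

  embed : Fin size → Fin n
  embed = lookup members

  embed-injective : Injective _≡_ _≡_ embed
  embed-injective = lookup-injective members (Unique.filter⁺ (λ y → T? (q y)) (Unique.allFin⁺ n))

  embed-member : ∀ i → q (embed i) ≡ true
  embed-member i = T⇒≡true (proj₂ (∈-filter⁻ (λ y → T? (q y)) {xs = allFin n} (∈-lookup {xs = members} i)))

  embed-onto : ∀ w → q w ≡ true → ∃ λ i → embed i ≡ w
  embed-onto w qw = Any.index w∈ , sym (lookup-index w∈)
    where
    w∈ : w ∈ members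
    w∈ = ∈-filter⁺ (λ y → T? (q y)) (∈-allFin w) (≡true⇒T qw)

  size< : ∀ w → q w ≡ false → size < n
  size< w qw = subst (size <_) (length-tabulate {n = n} (λ z → z))
    (filter-notAll (λ y → T? (q y)) (allFin n) (Any.map (λ { refl t → subst T qw t }) (∈-allFin w)))

Closed : ∀ {n} → Graph n → (Fin n → Bool) → Set
Closed G q = ∀ x w → q x ≡ true → G x w ≡ true → q w ≡ true

closed-complement : ∀ {n} (G : Graph n) q → IsSimple G → Closed G q → Closed G (λ w → not (q w))
closed-complement G q (sym-G , _) closed x w nqx exw with q w in qw
... | true  = ⊥-elim (Boolₚ.not-¬ (closed w x qw (trans (sym-G w x) exw)) (Equivalence.to T-not-≡ (≡true⇒T nqx)))
... | false = refl

closed-cycle : ∀ {n} (G : Graph n) q → Closed G q → ∀ m (c : Fin (3 + m) → Fin n) →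
  (∀ s t → cycleGraph m s t ≡ true → G (c s) (c t) ≡ true) → q (c zero) ≡ true → ∀ t → q (c t) ≡ true
closed-cycle G q closed m c edge q₀ t =
  subst (λ s → q (c s) ≡ true) (fromℕ<-toℕ t (toℕ<n t)) (along (toℕ t) (toℕ<n t))
  where
  along : ∀ p (p<k : p < 3 + m) → q (c (fromℕ< p<k)) ≡ true
  along zero    _     = q₀
  along (suc p) p+1<k = closed _ _ (along p p<k) (edge _ _ (cycleGraph-step m p p<k p+1<k))
    where
    p<k : p < 3 + m
    p<k = ≤-trans (n≤1+n (suc p)) p+1<k

module ClosedPart {n} (G : Graph n) (q : Fin n → Bool) (closed : Closed G q) where

  open Enumeration q public
  open Embedded G embed embed-injective public

  covered : ∀ i → Covered (embed i)
  covered i w ew = embed-onto w (closed _ w (embed-member i) ew)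

  admissible : Admissible G → Admissible H
  admissible (simple , subcubic , noK33 , noC5) =
    induced-simple simple , induced-subcubic subcubic ,
    (λ cp → noK33 (lift-component K33 cp (λ j → covered (proj₁ cp j)))) ,
    (λ cp → noC5 (lift-component C5 cp (λ j → covered (proj₁ cp j))))

  module Side (L : ListAssignment n) (g : Fin size → ℕ) (g-sl : SuperlinearLColoring H (λ i → L (embed i)) g)
              (f : Fin n → ℕ) (f∘e : ∀ i → f (embed i) ≡ g i) where

    open Restriction L g g-sl f f∘e

    side-∈ : ∀ w → q w ≡ true → f w ∈ L w
    side-∈ w qw with embed-onto w qw
    ... | i , refl = f∈L i

    side-proper : ∀ w z → q w ≡ true → G w z ≡ true → f w ≢ f z
    side-proper w z qw ewz with embed-onto w qw
    ... | i , refl with covered i z ewz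
    ...   | j , refl = f-proper i j ewz

    side-deg2 : ∀ w x y → q w ≡ true → deg G w ≡ 2 → G w x ≡ true → G w y ≡ true → x ≢ y →
      f x ≢ f y
    side-deg2 w x y qw dw ex ey x≢y with embed-onto w qw
    ... | i , refl with covered i x ex | covered i y ey
    ...   | a , refl | b , refl =
      f-deg2 i a b (trans (deg-induced-≡ i (covered i)) dw) ex ey (λ a≡b → x≢y (cong embed a≡b))

    side-maxDeg : ∀ a b → ∀ w x y z → q w ≡ true →
      let S = λ v → f v ≡ a ⊎ f v ≡ b in S w → S x → S y → S z →
      G w x ≡ true → G w y ≡ true → G w z ≡ true → x ≢ y → y ≢ z → x ≢ z → ⊥
    side-maxDeg a b w x y z qw sw sx sy sz ex ey ez with embed-onto w qw
    ... | i , refl with covered i x ex | covered i y ey | covered i z ez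
    ...   | i₁ , refl | i₂ , refl | i₃ , refl = f-maxDeg i i₁ i₂ i₃ sw sx sy sz ex ey ez

    side-noCycle : ∀ a b → (cy : HasCycleOn G (λ v → f v ≡ a ⊎ f v ≡ b)) →
      q (proj₁ (proj₂ cy) zero) ≡ true → ⊥
    side-noCycle a b cy@(m , c , _ , _ , edge) qc₀ =
      f-noCycle cy (λ t → embed-onto (c t) (closed-cycle G q closed m c edge qc₀ t))

SmallerChoosable : ℕ → Set
SmallerChoosable n = ∀ m → m < n → (H : Graph m) → Admissible H → Superlinearly4Choosable H

split-colourable : ∀ {n} (G : Graph n) → Admissible G → SmallerChoosable n →
  (q : Fin n → Bool) → Closed G q → ∀ u v → q u ≡ true → q v ≡ false →
  (L : ListAssignment n) → Size4 L → SuperlinearlyColorable G L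
split-colourable {n} G adm smaller q closed u v qu qv L size4 =
  f , (∈L , proper) , (λ a b → maxDeg a b , noCycle a b) , deg2
  where
  module A = ClosedPart G q closed
  module B = ClosedPart G (λ w → not (q w)) (closed-complement G q (proj₁ adm) closed)

  colour-side : ∀ {m} (e : Fin m → Fin n) → m < n → Admissible (induced G e) →
    Σ (Fin m → ℕ) λ g → SuperlinearLColoring (induced G e) (λ i → L (e i)) g
  colour-side {m} e m<n admH = smaller m m<n (induced G e) admH (λ i → L (e i)) (λ i → size4 (e i))

  sideA : Σ (Fin A.size → ℕ) λ g → SuperlinearLColoring A.H (λ i → L (A.embed i)) g
  sideA = colour-side A.embed (A.size< v qv) (A.admissible adm)

  sideB : Σ (Fin B.size → ℕ) λ g → SuperlinearLColoring B.H (λ i → L (B.embed i)) g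
  sideB = colour-side B.embed (B.size< u (cong not qu)) (B.admissible adm)

  g₁ : Fin A.size → ℕ
  g₁ = proj₁ sideA

  g₂ : Fin B.size → ℕ
  g₂ = proj₁ sideB

  glue : (w : Fin n) (b : Bool) → q w ≡ b → ℕ
  glue w true  qw = g₁ (proj₁ (A.embed-onto w qw))
  glue w false qw = g₂ (proj₁ (B.embed-onto w (cong not qw)))

  f : Fin n → ℕ
  f w = glue w (q w) refl

  glue-A : ∀ i b (qi : q (A.embed i) ≡ b) → glue (A.embed i) b qi ≡ g₁ i
  glue-A i true  qi = cong g₁ (A.embed-injective (proj₂ (A.embed-onto (A.embed i) qi)))
  glue-A i false qi with () ← trans (sym qi) (A.embed-member i)

  glue-B : ∀ i b (qi : q (B.embed i) ≡ b) → glue (B.embed i) b qi ≡ g₂ i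
  glue-B i false qi = cong g₂ (B.embed-injective (proj₂ (B.embed-onto (B.embed i) (cong not qi))))
  glue-B i true  qi with () ← trans (sym (cong not qi)) (B.embed-member i)

  module SA = A.Side L g₁ (proj₂ sideA) f (λ i → glue-A i (q (A.embed i)) refl)
  module SB = B.Side L g₂ (proj₂ sideB) f (λ i → glue-B i (q (B.embed i)) refl)

  side : ∀ w → q w ≡ true ⊎ not (q w) ≡ true
  side w with q w
  ... | true  = inj₁ refl
  ... | false = inj₂ refl

  ∈L : ∀ w → f w ∈ L w
  ∈L w = [ SA.side-∈ w , SB.side-∈ w ]′ (side w)

  proper : ∀ u w → G u w ≡ true → f u ≢ f w
  proper u w e = [ (λ qu → SA.side-proper u w qu e) , (λ qu → SB.side-proper u w qu e) ]′ (side u)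

  maxDeg : ∀ a b → MaxDeg≤2On G (λ v → f v ≡ a ⊎ f v ≡ b)
  maxDeg a b w x y z sw sx sy sz ex ey ez x≢y y≢z x≢z with side w
  ... | inj₁ qw = SA.side-maxDeg a b w x y z qw sw sx sy sz ex ey ez x≢y y≢z x≢z
  ... | inj₂ qw = SB.side-maxDeg a b w x y z qw sw sx sy sz ex ey ez x≢y y≢z x≢z

  noCycle : ∀ a b → ¬ HasCycleOn G (λ v → f v ≡ a ⊎ f v ≡ b)
  noCycle a b cy = [ SA.side-noCycle a b cy , SB.side-noCycle a b cy ]′ (side (proj₁ (proj₂ cy) zero))

  deg2 : ∀ w x y → deg G w ≡ 2 → G w x ≡ true → G w y ≡ true → x ≢ y → f x ≢ f y
  deg2 w x y dw ex ey x≢y with side w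
  ... | inj₁ qw = SA.side-deg2 w x y qw dw ex ey x≢y
  ... | inj₂ qw = SB.side-deg2 w x y qw dw ex ey x≢y

module Reachability {n} (G : Graph n) (u : Fin n) where

  within : ℕ → Fin n → Bool
  within zero    w = ⌊ w ≟ᶠ u ⌋
  within (suc k) w = within k w ∨ any (λ x → within k x ∧ G x w) (allFin n)

  within-sound : ∀ k w → within k w ≡ true → Reach G u w
  within-sound zero    w e with w ≟ᶠ u
  ... | yes refl = here
  within-sound (suc k) w e with Equivalence.to T-∨ (≡true⇒T e)
  ... | inj₁ t = within-sound k w (T⇒≡true t)
  ... | inj₂ t with Any.satisfied (any⁻ _ (allFin n) t)
  ...   | x , t′ with Equivalence.to T-∧ t′
  ...     | kx , ex = step (within-sound k x (T⇒≡true kx)) (T⇒≡true ex)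

  within-mono : ∀ k w → within k w ≡ true → within (suc k) w ≡ true
  within-mono k w e rewrite e = refl

  within-step : ∀ k x w → within k x ≡ true → G x w ≡ true → within (suc k) w ≡ true
  within-step k x w kx ex = T⇒≡true (Equivalence.from T-∨ (inj₂ (any⁺ _ (Any.map
    (λ { refl → Equivalence.from T-∧ (≡true⇒T kx , ≡true⇒T ex) }) (∈-allFin x)))))

  within-start : ∀ k → within k u ≡ true
  within-start zero with u ≟ᶠ u
  ... | yes _   = refl
  ... | no  u≢u = ⊥-elim (u≢u refl)
  within-start (suc k) = within-mono k u (within-start k)

  count : ℕ → ℕ
  count k = length (filterᵇ (within k) (allFin n))

  ∈-count⁺ : ∀ k w → within k w ≡ true → w ∈ filterᵇ (within k) (allFin n)
  ∈-count⁺ k w e = ∈-filter⁺ (λ y → T? (within k y)) (∈-allFin w) (≡true⇒T e)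

  ∈-count⁻ : ∀ k w → w ∈ filterᵇ (within k) (allFin n) → within k w ≡ true
  ∈-count⁻ k w w∈ = T⇒≡true (proj₂ (∈-filter⁻ (λ y → T? (within k y)) {xs = allFin n} w∈))

  count-unique : ∀ k → Unique (filterᵇ (within k) (allFin n))
  count-unique k = Unique.filter⁺ (λ y → T? (within k y)) (Unique.allFin⁺ n)

  count≤n : ∀ k → count k ≤ n
  count≤n k = subst (count k ≤_) (length-tabulate {n = n} (λ z → z))
    (unique-⊆-length-≤ _ (allFin n) (count-unique k) (λ {z} _ → ∈-allFin z))

  count-grows : ∀ k w → within (suc k) w ≡ true → within k w ≡ false → suc (count k) ≤ count (suc k)
  count-grows k w new old = unique-⊆-length-≤ (w ∷ filterᵇ (within k) (allFin n)) _
    (All.tabulate (λ z∈ w≡z → Boolₚ.not-¬ (∈-count⁻ k _ (subst (_∈ _) (sym w≡z) z∈)) old)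
      ∷ count-unique k)
    λ { (here refl) → ∈-count⁺ (suc k) w new
      ; (there z∈)  → ∈-count⁺ (suc k) _ (within-mono k _ (∈-count⁻ k _ z∈)) }

  Stable : ℕ → Set
  Stable k = ∀ w → within (suc k) w ≡ within k w

  stable-suc : ∀ k → Stable k → Stable (suc k)
  stable-suc k st w = cong₂ _∨_ (st w) (cong or (map-cong (λ x → cong (_∧ G x w) (st x)) (allFin n)))

  stable-+ : ∀ j → Stable j → ∀ t → Stable (t + j)
  stable-+ j st zero    = st
  stable-+ j st (suc t) = stable-suc (t + j) (stable-+ j st t)

  -- Every step either adds a vertex or reaches a fixed point, and there are only n vertices.
  stable-or-large : ∀ k → (Σ ℕ λ j → j ≤ k × Stable j) ⊎ suc k ≤ count k
  stable-or-large zero =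
    inj₂ (unique-⊆-length-≤ (u ∷ []) _ ([] ∷ []) λ { (here refl) → ∈-count⁺ 0 u (within-start 0) })
  stable-or-large (suc k) with stable-or-large k
  ... | inj₁ (j , j≤k , st) = inj₁ (j , ≤-trans j≤k (n≤1+n k) , st)
  ... | inj₂ large with any? (λ w → (within (suc k) w Boolₚ.≟ true) ×-dec (within k w Boolₚ.≟ false))
  ...   | yes (w , new , old) = inj₂ (≤-trans (s≤s large) (count-grows k w new old))
  ...   | no  noNew = inj₁ (k , n≤1+n k , stable)
    where
    stable : Stable k
    stable w with within k w Boolₚ.≟ true | within (suc k) w Boolₚ.≟ true
    ... | yes old | _       = trans (within-mono k w old) (sym old)
    ... | no  old | yes new = ⊥-elim (noNew (w , new , ¬-not old))
    ... | no  old | no  new = trans (¬-not new) (sym (¬-not old))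

  within-closed : Closed G (within n)
  within-closed x w nx exw with stable-or-large n
  ... | inj₂ large = ⊥-elim (<-irrefl refl (≤-trans large (count≤n n)))
  ... | inj₁ (j , j≤n , st) =
    trans (sym (subst Stable (m∸n+n≡m j≤n) (stable-+ j st (n ∸ j)) w)) (within-step n x w nx exw)

  reached-or-separated : ∀ v → Reach G u v ⊎ Σ (Fin n → Bool) λ q → Closed G q × q u ≡ true × q v ≡ false
  reached-or-separated v with within n v Boolₚ.≟ true
  ... | yes reached = inj₁ (within-sound n v reached)
  ... | no  missed  = inj₂ (within n , within-closed , within-start n , ¬-not missed)

uncolourable⇒connected : ∀ {n} (G : Graph n) → Admissible G → SmallerChoosable n →
  (L : ListAssignment n) → Size4 L → ¬ SuperlinearlyColorable G L → Connected G
uncolourable⇒connected G adm smaller L size4 uncolourable u v with Reachability.reached-or-separated G u v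
... | inj₁ reach = reach
... | inj₂ (q , closed , qu , qv) = ⊥-elim (uncolourable (split-colourable G adm smaller q closed u v qu qv L size4))

-- Vertices of degree at most one

-- The 5-cycle 0 1 2 3 4 with the pendant vertex 5 attached to 0.
pendantC5-nbrs : Fin 6 → List (Fin 6)
pendantC5-nbrs zero                                = # 1 ∷ # 4 ∷ # 5 ∷ []
pendantC5-nbrs (suc zero)                          = # 0 ∷ # 2 ∷ []
pendantC5-nbrs (suc (suc zero))                    = # 1 ∷ # 3 ∷ []
pendantC5-nbrs (suc (suc (suc zero)))              = # 2 ∷ # 4 ∷ []
pendantC5-nbrs (suc (suc (suc (suc zero))))        = # 0 ∷ # 3 ∷ []
pendantC5-nbrs (suc (suc (suc (suc (suc zero)))))  = # 0 ∷ []

pendantC5 : Graph 6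
pendantC5 i j = ⌊ j ∈ᶠ? pendantC5-nbrs i ⌋
  where open import Data.List.Membership.DecPropositional (_≟ᶠ_ {6}) using () renaming (_∈?_ to _∈ᶠ?_)

pendantC5-nbr : ∀ i j → pendantC5 i j ≡ true → j ∈ pendantC5-nbrs i
pendantC5-nbr i j e = toWitness (≡true⇒T e)

pendantC5-sym : ∀ i j → pendantC5 i j ≡ pendantC5 j i
pendantC5-sym = toWitness {a? = all? λ i → all? λ j → pendantC5 i j Boolₚ.≟ pendantC5 j i} _

pendantC5-cycle : ∀ (a b : Fin 5) → pendantC5 (a ↑ˡ 1) (b ↑ˡ 1) ≡ C5 a b
pendantC5-cycle = toWitness
  {a? = all? λ (a : Fin 5) → all? λ (b : Fin 5) → pendantC5 (a ↑ˡ 1) (b ↑ˡ 1) Boolₚ.≟ C5 a b} _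

pendantC5-pendant : ∀ (b : Fin 4) → pendantC5 (# 5) (suc b ↑ˡ 1) ≡ false
pendantC5-pendant = toWitness {a? = all? λ (b : Fin 4) → pendantC5 (# 5) (suc b ↑ˡ 1) Boolₚ.≟ false} _

rotate : Fin 5 → Fin 5 → Fin 5
rotate j a = fromℕ< (m%n<n (toℕ a + toℕ j) 5)

rotate-zero : ∀ j → rotate j zero ≡ j
rotate-zero = toWitness {a? = all? λ j → rotate j zero ≟ᶠ j} _

rotate-C5 : ∀ j a b → C5 (rotate j a) (rotate j b) ≡ C5 a b
rotate-C5 = toWitness {a? = all? λ j → all? λ a → all? λ b → C5 (rotate j a) (rotate j b) Boolₚ.≟ C5 a b} _

rotate-injective : ∀ j a b → rotate j a ≡ rotate j b → a ≡ b
rotate-injective = toWitness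
  {a? = all? λ j → all? λ a → all? λ b → (rotate j a ≟ᶠ rotate j b) →-dec (a ≟ᶠ b)} _

rotate-onto : ∀ j b → ∃ λ a → rotate j a ≡ b
rotate-onto = toWitness {a? = all? λ j → all? λ b → any? λ a → rotate j a ≟ᶠ b} _


module PendantC5Colouring (Lq : Fin 6 → List ℕ) (four : ∀ j → FourList (Lq j)) where

  -- Vertices 1, …, 5 must be rainbow, while 0 only needs a₁ ≢ a₅; in the order 0, 2, 3, 1, 4, 5
  -- every vertex has at most three colours to avoid.
  a₀ a₁ a₂ a₃ a₄ a₅ : ℕ
  a₀ = pick (Lq (# 0)) []
  a₂ = pick (Lq (# 2)) (a₀ ∷ [])
  a₃ = pick (Lq (# 3)) (a₀ ∷ a₂ ∷ [])
  a₁ = pick (Lq (# 1)) (a₀ ∷ a₂ ∷ a₃ ∷ [])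
  a₄ = pick (Lq (# 4)) (a₀ ∷ a₂ ∷ a₃ ∷ [])
  a₅ = pick (Lq (# 5)) (a₀ ∷ a₁ ∷ [])

  g : Fin 6 → ℕ
  g zero                               = a₀
  g (suc zero)                         = a₁
  g (suc (suc zero))                   = a₂
  g (suc (suc (suc zero)))             = a₃
  g (suc (suc (suc (suc zero))))       = a₄
  g (suc (suc (suc (suc (suc zero))))) = a₅

  g∈ : ∀ j → g j ∈ Lq j
  g∈ zero                               = pick-∈ (four _) z≤n
  g∈ (suc zero)                         = pick-∈ (four _) (s≤s (s≤s (s≤s z≤n)))
  g∈ (suc (suc zero))                   = pick-∈ (four _) (s≤s z≤n)
  g∈ (suc (suc (suc zero)))             = pick-∈ (four _) (s≤s (s≤s z≤n))
  g∈ (suc (suc (suc (suc zero))))       = pick-∈ (four _) (s≤s (s≤s (s≤s z≤n)))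
  g∈ (suc (suc (suc (suc (suc zero))))) = pick-∈ (four _) (s≤s (s≤s z≤n))

  a₂≢a₀ : a₂ ≢ a₀
  a₂≢a₀ = pick-≢ (four _) (s≤s z≤n) (here refl)
  a₃≢a₀ : a₃ ≢ a₀
  a₃≢a₀ = pick-≢ (four _) (s≤s (s≤s z≤n)) (here refl)
  a₃≢a₂ : a₃ ≢ a₂
  a₃≢a₂ = pick-≢ (four _) (s≤s (s≤s z≤n)) (there (here refl))
  a₁≢a₀ : a₁ ≢ a₀
  a₁≢a₀ = pick-≢ (four _) (s≤s (s≤s (s≤s z≤n))) (here refl)
  a₁≢a₂ : a₁ ≢ a₂
  a₁≢a₂ = pick-≢ (four _) (s≤s (s≤s (s≤s z≤n))) (there (here refl))
  a₁≢a₃ : a₁ ≢ a₃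
  a₁≢a₃ = pick-≢ (four _) (s≤s (s≤s (s≤s z≤n))) (there (there (here refl)))
  a₄≢a₀ : a₄ ≢ a₀
  a₄≢a₀ = pick-≢ (four _) (s≤s (s≤s (s≤s z≤n))) (here refl)
  a₄≢a₂ : a₄ ≢ a₂
  a₄≢a₂ = pick-≢ (four _) (s≤s (s≤s (s≤s z≤n))) (there (here refl))
  a₄≢a₃ : a₄ ≢ a₃
  a₄≢a₃ = pick-≢ (four _) (s≤s (s≤s (s≤s z≤n))) (there (there (here refl)))
  a₅≢a₀ : a₅ ≢ a₀
  a₅≢a₀ = pick-≢ (four _) (s≤s (s≤s z≤n)) (here refl)
  a₅≢a₁ : a₅ ≢ a₁
  a₅≢a₁ = pick-≢ (four _) (s≤s (s≤s z≤n)) (there (here refl))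

  proper : Proper pendantC5 g
  proper i j e = proper′ i j (pendantC5-nbr i j e)
    where
    proper′ : ∀ i j → j ∈ pendantC5-nbrs i → g i ≢ g j
    proper′ zero (suc zero) (here refl) = ≢-sym a₁≢a₀
    proper′ zero _ (there (here refl)) = ≢-sym a₄≢a₀
    proper′ zero _ (there (there (here refl))) = ≢-sym a₅≢a₀
    proper′ (suc zero) _ (here refl) = a₁≢a₀
    proper′ (suc zero) _ (there (here refl)) = a₁≢a₂
    proper′ (suc (suc zero)) _ (here refl) = ≢-sym a₁≢a₂
    proper′ (suc (suc zero)) _ (there (here refl)) = ≢-sym a₃≢a₂
    proper′ (suc (suc (suc zero))) _ (here refl) = a₃≢a₂
    proper′ (suc (suc (suc zero))) _ (there (here refl)) = ≢-sym a₄≢a₃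
    proper′ (suc (suc (suc (suc zero)))) _ (here refl) = a₄≢a₀
    proper′ (suc (suc (suc (suc zero)))) _ (there (here refl)) = a₄≢a₃
    proper′ (suc (suc (suc (suc (suc zero))))) _ (here refl) = a₅≢a₀

  rainbow : ∀ j → Rainbow pendantC5 g (suc j)
  rainbow zero = rainbow-of-two-nbrs pendantC5 g (# 1) (# 0) (# 2) (pendantC5-nbr (# 1)) (≢-sym a₂≢a₀)
  rainbow (suc zero) = rainbow-of-two-nbrs pendantC5 g (# 2) (# 1) (# 3) (pendantC5-nbr (# 2)) a₁≢a₃
  rainbow (suc (suc zero)) = rainbow-of-two-nbrs pendantC5 g (# 3) (# 2) (# 4) (pendantC5-nbr (# 3)) (≢-sym a₄≢a₂)
  rainbow (suc (suc (suc zero))) =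
    rainbow-of-two-nbrs pendantC5 g (# 4) (# 0) (# 3) (pendantC5-nbr (# 4)) (≢-sym a₃≢a₀)
  rainbow (suc (suc (suc (suc zero)))) =
    rainbow-of-one-nbr pendantC5 g (# 5) (# 0) (λ x e → only (pendantC5-nbr (# 5) x e))
    where only : ∀ {x} → x ∈ # 0 ∷ [] → x ≡ # 0
          only (here x≡0) = x≡0

  rainbowEdged : RainbowEdged pendantC5 g
  rainbowEdged = proper , noThree , rainbowEdge
    where
    noThree : ∀ w → NoThreeAlike pendantC5 g w
    noThree zero =
      noThreeAlike-of-three-nbrs pendantC5 g (# 0) (# 1) (# 4) (# 5) (pendantC5-nbr (# 0)) (≢-sym a₅≢a₁)
    noThree (suc j) = Rainbow⇒NoThreeAlike pendantC5 g (suc j) (rainbow j)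
    rainbowEdge : ∀ u v → pendantC5 u v ≡ true → Rainbow pendantC5 g u ⊎ Rainbow pendantC5 g v
    rainbowEdge (suc i) _       _ = inj₁ (rainbow i)
    rainbowEdge zero    (suc j) _ = inj₂ (rainbow j)
    rainbowEdge zero    zero    ()

K33-three-nbrs : ∀ j → Σ (Fin 6) λ a → Σ (Fin 6) λ b → Σ (Fin 6) λ c →
  K33 j a ≡ true × K33 j b ≡ true × K33 j c ≡ true × a ≢ b × a ≢ c × b ≢ c
K33-three-nbrs zero                                = # 3 , # 4 , # 5 , refl , refl , refl , (λ ()) , (λ ()) , (λ ())
K33-three-nbrs (suc zero)                          = # 3 , # 4 , # 5 , refl , refl , refl , (λ ()) , (λ ()) , (λ ())
K33-three-nbrs (suc (suc zero))                    = # 3 , # 4 , # 5 , refl , refl , refl , (λ ()) , (λ ()) , (λ ())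
K33-three-nbrs (suc (suc (suc zero)))              = # 0 , # 1 , # 2 , refl , refl , refl , (λ ()) , (λ ()) , (λ ())
K33-three-nbrs (suc (suc (suc (suc zero))))        = # 0 , # 1 , # 2 , refl , refl , refl , (λ ()) , (λ ()) , (λ ())
K33-three-nbrs (suc (suc (suc (suc (suc zero))))) = # 0 , # 1 , # 2 , refl , refl , refl , (λ ()) , (λ ()) , (λ ())

module PendantDeletion {n} (G : Graph (suc n)) (simple : IsSimple G) (subcubic : Subcubic G)
                       (v u : Fin (suc n)) (vu : G v u ≡ true) (only-u : ∀ x → G v x ≡ true → x ≡ u) where

  e : Fin n → Fin (suc n)
  e = punchIn v

  e-injective : Injective _≡_ _≡_ e
  e-injective = punchIn-injective v _ _

  open Embedded G e e-injective public

  uv : G u v ≡ true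
  uv = trans (proj₁ simple u v) vu

  u≢v : u ≢ v
  u≢v refl = Boolₚ.not-¬ (proj₂ simple v) vu

  nbr-of-v : ∀ x → G x v ≡ true → x ≡ u
  nbr-of-v x xv = only-u x (trans (proj₁ simple v x) xv)

  vertex-cases : ∀ w → w ≡ v ⊎ ∃ λ i → e i ≡ w
  vertex-cases w with v ≟ᶠ w
  ... | yes v≡w = inj₁ (sym v≡w)
  ... | no  v≢w = inj₂ (punchOut v≢w , punchIn-punchOut v≢w)

  u′ : Fin n
  u′ = punchOut (λ v≡u → u≢v (sym v≡u))

  e-u′ : e u′ ≡ u
  e-u′ = punchIn-punchOut _

  deg-v≤1 : deg G v ≤ 1
  deg-v≤1 = deg-≤ G v (u ∷ []) (λ x vx → here (only-u x vx))

  covered-off-u : ∀ i → e i ≢ u → Covered (e i)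
  covered-off-u i ei≢u w ew with vertex-cases w
  ... | inj₁ refl = ⊥-elim (ei≢u (nbr-of-v (e i) ew))
  ... | inj₂ pre  = pre

  admissible : Admissible G → (∀ (cp : HasComponentIso H C5) → ¬ ∃ λ j → proj₁ cp j ≡ u′) → Admissible H
  admissible (_ , _ , noK33 , noC5) noC5-at-u =
    induced-simple simple , induced-subcubic subcubic , noK33′ , noC5′
    where
    avoiding : ∀ {k} (K : Graph k) (cp : HasComponentIso H K) → ¬ (∃ λ j → proj₁ cp j ≡ u′) →
      HasComponentIso G K
    avoiding K cp off =
      lift-component K cp (λ j → covered-off-u _ (λ eψ≡u → off (j , e-injective (trans eψ≡u (sym e-u′)))))

    -- u would have its three neighbours in K_{3,3} besides v
    noK33′ : ¬ HasComponentIso H K33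
    noK33′ cp@(ψ , ψ-inj , ψ-edge , _) with any? (λ j → ψ j ≟ᶠ u′)
    ... | no  off         = noK33 (avoiding K33 cp off)
    ... | yes (j , ψj≡u′) with K33-three-nbrs j
    ...   | a , b , c , ja , jb , jc , a≢b , a≢c , b≢c = 1+n≰n (≤-trans
            (deg-≥4 G u (edge a ja) (edge b jb) (edge c jc) uv
              (distinct a≢b) (distinct a≢c) (punchInᵢ≢i v _) (distinct b≢c) (punchInᵢ≢i v _)
              (punchInᵢ≢i v _))
            (subcubic u))
      where
      edge : ∀ x → K33 j x ≡ true → G u (e (ψ x)) ≡ true
      edge x jx = subst (λ w → G w (e (ψ x)) ≡ true) (trans (cong e ψj≡u′) e-u′) (trans (ψ-edge j x) jx)
      distinct : ∀ {x y} → x ≢ y → e (ψ x) ≢ e (ψ y)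
      distinct x≢y eq = x≢y (ψ-inj (e-injective eq))

    noC5′ : ¬ HasComponentIso H C5
    noC5′ cp with any? (λ j → proj₁ cp j ≟ᶠ u′)
    ... | no  off = noC5 (avoiding C5 cp off)
    ... | yes at  = noC5-at-u cp at

  module Extension (L : ListAssignment (suc n)) (size4 : Size4 L)
                   (g : Fin n → ℕ) (g-sl : SuperlinearLColoring H (λ i → L (e i)) g) where

    extend : ℕ → Fin (suc n) → ℕ
    extend c w with v ≟ᶠ w
    ... | yes _   = c
    ... | no  v≢w = g (punchOut v≢w)

    extend-v : ∀ c → extend c v ≡ c
    extend-v c with v ≟ᶠ v
    ... | yes _   = refl
    ... | no  v≢v = ⊥-elim (v≢v refl)

    extend-e : ∀ c i → extend c (e i) ≡ g i
    extend-e c i with v ≟ᶠ e i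
    ... | yes v≡ei = ⊥-elim (punchInᵢ≢i v i (sym v≡ei))
    ... | no  v≢ei = cong g (e-injective (punchIn-punchOut v≢ei))

    -- Giving v the colour of u in the base colouring makes the colours v must avoid
    -- the colours of the neighbours of u: at most three.
    avoid : List ℕ
    avoid = map (extend (g u′)) (nbrs G u)

    few : length avoid ≤ 3
    few = subst (_≤ 3) (sym (length-map (extend (g u′)) (nbrs G u))) (subcubic u)

    cv : ℕ
    cv = pick (L v) avoid

    cv-∈ : cv ∈ L v
    cv-∈ = pick-∈ (size4 v) few

    cv-≢ : ∀ i → e i ≡ u ⊎ G u (e i) ≡ true → cv ≢ g i
    cv-≢ i near = pick-≢ (size4 v) few (avoided near)
      where
      avoided : e i ≡ u ⊎ G u (e i) ≡ true → g i ∈ avoid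
      avoided (inj₁ ei≡u) =
        subst (_∈ avoid) (trans (extend-v (g u′)) (cong g (e-injective (trans e-u′ (sym ei≡u)))))
          (∈-map⁺ (extend (g u′)) (∈-nbrs⁺ G uv))
      avoided (inj₂ u~ei) = subst (_∈ avoid) (extend-e (g u′) i) (∈-map⁺ (extend (g u′)) (∈-nbrs⁺ G u~ei))

    f : Fin (suc n) → ℕ
    f = extend cv

    open Restriction L g g-sl f (extend-e cv)

    f-v≢ : ∀ i → e i ≡ u ⊎ G u (e i) ≡ true → f v ≢ f (e i)
    f-v≢ i near eq = cv-≢ i near (trans (sym (extend-v cv)) (trans eq (extend-e cv i)))

    at-u : ∀ {w x} → G w x ≡ true → x ≡ v → w ≡ u
    at-u {w} wx refl = nbr-of-v w wx

    ∈L : ∀ w → f w ∈ L w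
    ∈L w with vertex-cases w
    ... | inj₁ refl       = subst (_∈ L v) (sym (extend-v cv)) cv-∈
    ... | inj₂ (i , refl) = f∈L i

    proper : ∀ w z → G w z ≡ true → f w ≢ f z
    proper w z wz with vertex-cases w | vertex-cases z
    ... | inj₁ refl       | inj₁ refl       = ⊥-elim (Boolₚ.not-¬ (proj₂ simple v) wz)
    ... | inj₁ refl       | inj₂ (j , refl) = f-v≢ j (inj₁ (only-u _ wz))
    ... | inj₂ (i , refl) | inj₁ refl       = ≢-sym (f-v≢ i (inj₁ (at-u wz refl)))
    ... | inj₂ (i , refl) | inj₂ (j , refl) = f-proper i j wz

    deg2 : ∀ w x y → deg G w ≡ 2 → G w x ≡ true → G w y ≡ true → x ≢ y → f x ≢ f y
    deg2 w x y dw wx wy x≢y with vertex-cases w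
    ... | inj₁ refl = ⊥-elim (1+n≰n (subst (_≤ 1) dw deg-v≤1))
    ... | inj₂ (i , refl) with vertex-cases x | vertex-cases y
    ...   | inj₁ refl       | inj₁ refl       = ⊥-elim (x≢y refl)
    ...   | inj₁ refl       | inj₂ (b , refl) =
      f-v≢ b (inj₂ (subst (λ t → G t (e b) ≡ true) (at-u wx refl) wy))
    ...   | inj₂ (a , refl) | inj₁ refl       =
      ≢-sym (f-v≢ a (inj₂ (subst (λ t → G t (e a) ≡ true) (at-u wy refl) wx)))
    ...   | inj₂ (a , refl) | inj₂ (b , refl) with e i ≟ᶠ u
    ...     | yes refl = ⊥-elim (1+n≰n (subst (3 ≤_) dw
                (deg-≥3 G u wx wy uv x≢y (punchInᵢ≢i v a) (punchInᵢ≢i v b))))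
    ...     | no  ei≢u = f-deg2 i a b (trans (deg-induced-≡ i (covered-off-u i ei≢u)) dw) wx wy
                (λ a≡b → x≢y (cong e a≡b))

    -- In a two-colour class, v and y both differ from their common neighbour u, so they would
    -- share a colour.
    class-at-u : ∀ {a b} y → G u y ≡ true → y ≢ v →
      let S = λ t → f t ≡ a ⊎ f t ≡ b in S u → S v → S y → ⊥
    class-at-u y uy y≢v su sv sy with vertex-cases y
    ... | inj₁ y≡v       = y≢v y≡v
    ... | inj₂ (j , refl) = f-v≢ j (inj₂ uy)
          (two-colours su sv sy (λ e′ → proper u v uv (sym e′)) (λ e′ → proper u y uy (sym e′)))

    maxDeg : ∀ a b → MaxDeg≤2On G (λ t → f t ≡ a ⊎ f t ≡ b)
    maxDeg a b w x y z sw sx sy sz wx wy wz x≢y y≢z x≢z with vertex-cases w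
    ... | inj₁ refl = 1+n≰n (≤-trans (deg-≥2 G v wx wy x≢y) deg-v≤1)
    ... | inj₂ (i , refl) with vertex-cases x | vertex-cases y | vertex-cases z
    ...   | inj₁ refl | _ | _ =
      class-at-u y (subst (λ t → G t y ≡ true) (at-u wx refl) wy) (λ y≡v → x≢y (sym y≡v))
                                  (subst S (at-u wx refl) sw) sx sy
      where S = λ t → f t ≡ a ⊎ f t ≡ b
    ...   | inj₂ _ | inj₁ refl | _ = class-at-u x (subst (λ t → G t x ≡ true) (at-u wy refl) wx) x≢y
                                       (subst S (at-u wy refl) sw) sy sx
      where S = λ t → f t ≡ a ⊎ f t ≡ b
    ...   | inj₂ _ | inj₂ _ | inj₁ refl = class-at-u x (subst (λ t → G t x ≡ true) (at-u wz refl) wx) x≢z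
                                            (subst S (at-u wz refl) sw) sz sx
      where S = λ t → f t ≡ a ⊎ f t ≡ b
    ...   | inj₂ (i₁ , refl) | inj₂ (i₂ , refl) | inj₂ (i₃ , refl) =
      f-maxDeg i i₁ i₂ i₃ sw sx sy sz wx wy wz x≢y y≢z x≢z

    noCycle : ∀ a b → ¬ HasCycleOn G (λ t → f t ≡ a ⊎ f t ≡ b)
    noCycle a b cy@(m , c , c-inj , _ , edge) with any? (λ t → c t ≟ᶠ v)
    ... | yes (t , refl) with cycleGraph-two-nbrs m t
    ...   | s , s′ , ts , ts′ , s≢s′ =
      1+n≰n (≤-trans (deg-≥2 G v (edge t s ts) (edge t s′ ts′) (λ eq → s≢s′ (c-inj eq))) deg-v≤1)
    noCycle a b cy@(m , c , c-inj , _ , edge) | no off =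
      f-noCycle cy (λ t → [ (λ ct≡v → ⊥-elim (off (t , ct≡v))) , (λ pre → pre) ]′ (vertex-cases (c t)))

    colourable : SuperlinearlyColorable G L
    colourable = f , (∈L , proper) , (λ a b → maxDeg a b , noCycle a b) , deg2

  -- G - v has a 5-cycle component through u; as G is connected, G is that cycle plus v.
  module C5ThroughU (connected : Connected G) (cp : HasComponentIso H C5) (j₀ : Fin 5)
                    (ψj₀≡u′ : proj₁ cp j₀ ≡ u′) (L : ListAssignment (suc n)) (size4 : Size4 L) where

    ψ : Fin 5 → Fin n
    ψ = proj₁ cp

    ρ : Fin 5 → Fin (suc n)
    ρ a = e (ψ (rotate j₀ a))

    ρ-zero : ρ zero ≡ u
    ρ-zero = trans (cong (λ j → e (ψ j)) (rotate-zero j₀)) (trans (cong e ψj₀≡u′) e-u′)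

    ρ-injective : Injective _≡_ _≡_ ρ
    ρ-injective {a} {b} eq = rotate-injective j₀ a b (proj₁ (proj₂ cp) (e-injective eq))

    ρ-edge : ∀ a b → G (ρ a) (ρ b) ≡ C5 a b
    ρ-edge a b = trans (proj₁ (proj₂ (proj₂ cp)) (rotate j₀ a) (rotate j₀ b)) (rotate-C5 j₀ a b)

    on-cycle-or-v : ∀ w → Reach G v w → w ≡ v ⊎ ∃ λ a → ρ a ≡ w
    on-cycle-or-v w here = inj₁ refl
    on-cycle-or-v w (step {x} r xw) with on-cycle-or-v x r
    ... | inj₁ refl = inj₂ (zero , trans ρ-zero (sym (only-u w xw)))
    ... | inj₂ (a , refl) with vertex-cases w
    ...   | inj₁ w≡v       = inj₁ w≡v
    ...   | inj₂ (i , refl) with proj₂ (proj₂ (proj₂ cp)) (rotate j₀ a) i xw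
    ...     | j , refl with rotate-onto j₀ j
    ...       | b , refl = inj₂ (b , refl)

    from : Fin 6 → Fin (suc n)
    from j = [ ρ , (λ _ → v) ]′ (splitAt 5 j)

    from-↑ˡ : ∀ a → from (a ↑ˡ 1) ≡ ρ a
    from-↑ˡ a = cong [ ρ , (λ _ → v) ]′ (splitAt-↑ˡ 5 a 1)

    from-onto : ∀ w → ∃ λ j → from j ≡ w
    from-onto w with on-cycle-or-v w (connected v w)
    ... | inj₁ refl       = # 5 , refl
    ... | inj₂ (a , refl) = a ↑ˡ 1 , from-↑ˡ a

    six-cases : ∀ j → (∃ λ a → a ↑ˡ 1 ≡ j) ⊎ j ≡ # 5
    six-cases j with splitAt 5 j in eq
    ... | inj₁ a    = inj₁ (a , splitAt⁻¹-↑ˡ eq)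
    ... | inj₂ zero = inj₂ (sym (splitAt⁻¹-↑ʳ eq))

    v-ρ : ∀ b → G v (ρ b) ≡ pendantC5 (# 5) (b ↑ˡ 1)
    v-ρ zero    = trans (cong (G v) ρ-zero) vu
    v-ρ (suc b) with G v (ρ (suc b)) in vρ
    ... | true  with () ← ρ-injective {suc b} {zero} (trans (only-u _ vρ) (sym ρ-zero))
    ... | false = sym (pendantC5-pendant b)

    exact : ∀ i j → G (from i) (from j) ≡ pendantC5 i j
    exact i j with six-cases i | six-cases j
    ... | inj₁ (a , refl) | inj₁ (b , refl) =
      trans (cong₂ G (from-↑ˡ a) (from-↑ˡ b)) (trans (ρ-edge a b) (sym (pendantC5-cycle a b)))
    ... | inj₂ refl       | inj₁ (b , refl) = trans (cong (G v) (from-↑ˡ b)) (v-ρ b)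
    ... | inj₁ (a , refl) | inj₂ refl       =
      trans (cong (λ x → G x v) (from-↑ˡ a))
        (trans (proj₁ simple (ρ a) v) (trans (v-ρ a) (pendantC5-sym (# 5) (a ↑ˡ 1))))
    ... | inj₂ refl       | inj₂ refl       = proj₂ simple v

    open PendantC5Colouring (λ j → L (from j)) (λ j → size4 (from j))

    to : Fin (suc n) → Fin 6
    to w = proj₁ (from-onto w)

    from-to : ∀ w → from (to w) ≡ w
    from-to w = proj₂ (from-onto w)

    -- Only u, the image of vertex 0, fails to be rainbow, and u has degree three.
    rainbow-deg2 : ∀ w → deg G w ≡ 2 → Rainbow pendantC5 g (to w)
    rainbow-deg2 w dw with to w | from-to w
    ... | suc j | _    = rainbow j
    ... | zero  | refl = ⊥-elim (1+n≰n (subst (3 ≤_) dw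
          (deg-≥3 G (from zero) (exact zero (# 1)) (exact zero (# 4)) (exact zero (# 5))
            (λ eq → 1≢4 (ρ-injective eq)) (λ eq → punchInᵢ≢i v _ eq) (λ eq → punchInᵢ≢i v _ eq))))
      where 1≢4 : # 1 ≢ # 4
            1≢4 ()

    colourable : SuperlinearlyColorable G L
    colourable = superlinear-pullback G pendantC5 to from from-to
      (λ w z wz → trans (sym (exact (to w) (to z)))
                    (subst₂ (λ x y → G x y ≡ true) (sym (from-to w)) (sym (from-to z)) wz))
      L g g∈ rainbowEdged rainbow-deg2

single-vertex-colourable : (G : Graph 1) → IsSimple G → (L : ListAssignment 1) → Size4 L →
  SuperlinearlyColorable G L
single-vertex-colourable G simple L size4 =
  f , superlinear-of-rainbowEdged G L f (λ { zero → pick-∈ (size4 zero) z≤n })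
        (proper , (λ w → Rainbow⇒NoThreeAlike G f w (rainbow w)) , (λ w _ _ → inj₁ (rainbow w)))
        (λ w _ → rainbow w)
  where
  f : Fin 1 → ℕ
  f _ = pick (L zero) []
  rainbow : ∀ w → Rainbow G f w
  rainbow _ zero zero _ _ x≢y = ⊥-elim (x≢y refl)
  proper : Proper G f
  proper zero zero e = ⊥-elim (Boolₚ.not-¬ (proj₂ simple zero) e)

Reach⇒nbr : ∀ {n} (G : Graph n) {v w} → Reach G v w → w ≢ v → ∃ λ x → G v x ≡ true
Reach⇒nbr G here w≢v = ⊥-elim (w≢v refl)
Reach⇒nbr G {v} (step {x} r xw) w≢v with x ≟ᶠ v
... | yes refl = _ , xw
... | no  x≢v  = Reach⇒nbr G r x≢v

another-vertex : ∀ {n} (v : Fin (suc (suc n))) → ∃ λ w → w ≢ v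
another-vertex zero    = suc zero , λ ()
another-vertex (suc _) = zero , λ ()

connected-isolated-colourable : ∀ {n} (G : Graph (suc n)) → IsSimple G → Connected G → ∀ v → deg G v ≡ 0 →
  (L : ListAssignment (suc n)) → Size4 L → SuperlinearlyColorable G L
connected-isolated-colourable {zero}  G simple _ _ _ L size4 = single-vertex-colourable G simple L size4
connected-isolated-colourable {suc n} G _ connected v d0 _ _ with another-vertex v
... | w , w≢v with Reach⇒nbr G (connected v w) w≢v
...   | x , vx with () ← subst (1 ≤_) d0 (deg-≥ G v (x ∷ []) ([] ∷ []) λ { (here refl) → vx })

uncolourable⇒deg≥2 : ∀ {n} (G : Graph n) → Admissible G → SmallerChoosable n →
  (L : ListAssignment n) → Size4 L → ¬ SuperlinearlyColorable G L → Connected G → ∀ v → 2 ≤ deg G v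
uncolourable⇒deg≥2 {suc n} G adm@(simple , subcubic , _) smaller L size4 uncolourable connected v
  with deg G v in dv
... | suc (suc _) = s≤s (s≤s z≤n)
... | zero = ⊥-elim (uncolourable (connected-isolated-colourable G simple connected v dv L size4))
... | suc zero with deg≡1⇒unique-nbr G v dv
...   | u , vu , only-u =
  ⊥-elim (uncolourable (Extension.colourable L size4 (proj₁ colouringH) (proj₂ colouringH)))
  where
  open PendantDeletion G simple subcubic v u vu only-u
  admH : Admissible H
  admH = admissible adm λ { cp (j₀ , at-u) →
    uncolourable (C5ThroughU.colourable connected cp j₀ at-u L size4) }
  colouringH : Σ (Fin n → ℕ) λ g → SuperlinearLColoring H (λ i → L (e i)) g
  colouringH = smaller n ≤-refl H admH (λ i → L (e i)) (λ i → size4 (e i))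

Iso⇒HasComponentIso : ∀ {n k} (G : Graph n) (K : Graph k) → Iso G K → HasComponentIso G K
Iso⇒HasComponentIso G K (φ , iso) = from , from-injective , edge , λ _ w _ → to w , strictlyInverseʳ w
  where
  open Inverse φ
  from-injective : Injective _≡_ _≡_ from
  from-injective {i} {j} eq = trans (sym (strictlyInverseˡ i)) (trans (cong to eq) (strictlyInverseˡ j))
  edge : ∀ i j → G (from i) (from j) ≡ K i j
  edge i j = trans (sym (iso (from i) (from j))) (cong₂ K (strictlyInverseˡ i) (strictlyInverseˡ j))

lemma3 : (n : ℕ) (G : Graph n) → MinimumCounterexample G →
    Connected G × (∀ v → 2 ≤ deg G v) × ¬ IsCycle G
lemma3 n G (adm , (L , size4 , uncolourable) , smaller) =
  connected , uncolourable⇒deg≥2 G adm smaller L size4 uncolourable connected , not-cycle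
  where
  connected : Connected G
  connected = uncolourable⇒connected G adm smaller L size4 uncolourable

  not-cycle : ¬ IsCycle G
  not-cycle (m , iso) with m ≟ 2
  ... | yes refl = proj₂ (proj₂ (proj₂ adm)) (Iso⇒HasComponentIso G C5 iso)
  ... | no  m≢2  = uncolourable (cycle-superlinearly-colourable G m iso m≢2 L size4)
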